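{- Let $\Sigma$ be an alphabet, $\mathcal F$ any family of graphs over $\Sigma$, and $k\ge1$. For every deterministic $k$-head graph-walking automaton with nested pebbles $\mathcal A$ over $\Sigma$ there is a closed formula $\phi$ of first-order logic with $k$-ary deterministic transitive closure over $\Sigma$ such that for every graph $g\in\mathcal F$: $g\in L(\mathcal A)$ iff $g\models\phi$. That is, on $\mathcal F$, $\mathrm{DPTWA}^k\subseteq\mathrm{FO{+}DTC}^k$.
   Context: Graphs: nonempty finite directed graphs, weakly connected, whose nodes and edges are labelled from a common alphabet $\Sigma$, such that no node has two outgoing edges with the same label nor two incoming edges with the same label (parallel edges and loops allowed). Logic for graphs: node variables; atomic formulas $\mathrm{lab}_\sigma(x)$ ($x$ has label $\sigma$), $\mathrm{edg}_\sigma(x,y)$ (there is a $\sigma$-labelled edge from $x$ to $y$), $x=y$; closed under $\neg,\wedge,\vee,\exists,\forall$. $k$-ary transitive closure: for a formula $\phi$ with $k$-tuples $\bar x,\bar y$ of distinct free variables (other free variables fixed), $g\models\phi^*(\bar u,\bar v)$ iff there are $k$-tuples of nodes $\bar u_0=\bar u,\dots,\bar u_n=\bar v$ ($n\ge0$) with $g\models\phi(\bar u_i,\bar u_{i+1})$ for all $i<n$; it is deterministic if $\phi$ is functional (for every graph, valuation of the other variables and $\bar u$, at most one $\bar v$ satisfies $\phi(\bar u,\bar v)$). FO+DTC$^k$ allows only deterministic $k$-ary transitive closure. Automata: a $k$-head graph-walking automaton with nested pebbles is $\mathcal A=(Q,\Sigma,X,q_0,A,I)$ with finite states $Q$, finite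 pebble set $X$, initial state $q_0$, accepting states $A$, and finite set $I$ of instructions $\langle p,\chi,q\rangle$ where $\chi$ is an operation $\mathrm{inmove}_{i,\sigma}$ / $\mathrm{outmove}_{i,\sigma}$ (move head $i$ backwards along its incoming / forwards along its outgoing edge labelled $\sigma$), $\mathrm{drop}_i(x)$ (push $(x,u[i])$ on the pebble stack, if $x$ is not on it), $\mathrm{retrieve}(x)$ (pop the top pair if its pebble is $x$, regardless of head positions), or a test $\mathrm{lab}_{i,\sigma}$, $\mathrm{peb}_i(x)$, $\mathrm{inedge}_{i,\sigma}$, $\mathrm{outedge}_{i,\sigma}$ (node $u[i]$ under head $i$ has label $\sigma$; pebble $x$ lies on $u[i]$; $u[i]$ has an incoming / outgoing $\sigma$-labelled edge) or its negation; tests change nothing. Configurations are $[p,\bar u,\alpha]$ (state, $k$-tuple of head nodes, stack of (pebble,node) pairs); a configuration is halting if no instruction applies. For a node $u$, $\mathrm{acc}(u)$ means that from $[q_0,(u,\dots,u),\varepsilon]$ some halting configuration $[q,\bar v,\varepsilon]$ with $q\in A$ is reachable. It is required that for every graph over $\Sigma$, $\mathrm{acc}(u_1)$ implies $\mathrm{acc}(u_2)$ for all nodes $u_1,u_2$; then $L(\mathcal A)$ is the set of graphs $g$ with $\mathrm{acc}(u)$ for every node $u$. $\mathcal A$ is deterministic if any two distinct instructions from the same state have $\chi_1=\neg\chi_2$ or $\chi_2=\neg\chi_1$. -}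

module Defs where

open import Data.Nat using (ℕ; zero; suc; _≤_; _<_; _≡ᵇ_)
open import Data.Bool using (Bool; true; false; if_then_else_)
open import Data.Fin using (Fin)
open import Data.Vec using (Vec; []; _∷_; lookup; replicate; _[_]≔_; toList)
open import Data.List using (List; []; _∷_; _++_)
open import Data.List.Membership.Propositional using (_∈_; _∉_)
import Data.Vec.Membership.Propositional as VM
open import Data.List.Relation.Unary.Unique.Propositional using (Unique)
open import Data.Product using (Σ; ∃; _×_; _,_)
open import Data.Sum using (_⊎_)
open import Data.Unit using (⊤)
open import Relation.Nullary using (¬_)
open import Relation.Binary.PropositionalEquality using (_≡_; _≢_)
open import Relation.Binary.Construct.Closure.ReflexiveTransitive using (Star)

record Graph (s : ℕ) : Set where
  field
    n        : ℕ
    nonempty : 0 < n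
    m        : ℕ
    nlab     : Fin n → Fin s
    src      : Fin m → Fin n
    tgt      : Fin m → Fin n
    elab     : Fin m → Fin s
    out-det  : ∀ e e' → src e ≡ src e' → elab e ≡ elab e' → e ≡ e'
    in-det   : ∀ e e' → tgt e ≡ tgt e' → elab e ≡ elab e' → e ≡ e'
    connected : ∀ u v → Star (λ a b → ∃ λ e → (src e ≡ a × tgt e ≡ b) ⊎ (src e ≡ b × tgt e ≡ a)) u v

open Graph public

Node : ∀ {s} → Graph s → Set
Node g = Fin (n g)

data Formula (s : ℕ) : Set where
  lab  : Fin s → ℕ → Formula s
  edg  : Fin s → ℕ → ℕ → Formula s
  eq   : ℕ → ℕ → Formula s
  neg  : Formula s → Formula s
  and  : Formula s → Formula s → Formula s
  or   : Formula s → Formula s → Formula s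
  ex   : ℕ → Formula s → Formula s
  all  : ℕ → Formula s → Formula s
  -- tc j xs ys us vs φ  is  φ^*(us, vs) where φ = φ(xs, ys), all tuples of length j
  tc   : (j : ℕ) → (xs ys us vs : Vec ℕ j) → Formula s → Formula s

_[_≔_] : ∀ {A : Set} → (ℕ → A) → ℕ → A → (ℕ → A)
(ν [ x ≔ a ]) z = if z ≡ᵇ x then a else ν z

_[_≔*_] : ∀ {A : Set} {j} → (ℕ → A) → Vec ℕ j → Vec A j → (ℕ → A)
ν [ [] ≔* [] ] = ν
ν [ x ∷ xs ≔* a ∷ as ] = (ν [ x ≔ a ]) [ xs ≔* as ]

mapV : ∀ {A B : Set} {j} → (A → B) → Vec A j → Vec B j
mapV f [] = []
mapV f (x ∷ xs) = f x ∷ mapV f xs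

Sat : ∀ {s} (g : Graph s) → (ℕ → Node g) → Formula s → Set
Sat g ν (lab σ x)   = nlab g (ν x) ≡ σ
Sat g ν (edg σ x y) = ∃ λ e → src g e ≡ ν x × tgt g e ≡ ν y × elab g e ≡ σ
Sat g ν (eq x y)    = ν x ≡ ν y
Sat g ν (neg φ)     = ¬ Sat g ν φ
Sat g ν (and φ ψ)   = Sat g ν φ × Sat g ν ψ
Sat g ν (or φ ψ)    = Sat g ν φ ⊎ Sat g ν ψ
Sat g ν (ex x φ)    = Σ (Node g) λ a → Sat g (ν [ x ≔ a ]) φ
Sat g ν (all x φ)   = (a : Node g) → Sat g (ν [ x ≔ a ]) φ
Sat g ν (tc j xs ys us vs φ) =
  Star (λ a b → Sat g ((ν [ xs ≔* a ]) [ ys ≔* b ]) φ) (mapV ν us) (mapV ν vs)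

Free : ∀ {s} → ℕ → Formula s → Set
Free z (lab σ x)   = z ≡ x
Free z (edg σ x y) = z ≡ x ⊎ z ≡ y
Free z (eq x y)    = z ≡ x ⊎ z ≡ y
Free z (neg φ)     = Free z φ
Free z (and φ ψ)   = Free z φ ⊎ Free z ψ
Free z (or φ ψ)    = Free z φ ⊎ Free z ψ
Free z (ex x φ)    = z ≢ x × Free z φ
Free z (all x φ)   = z ≢ x × Free z φ
Free z (tc j xs ys us vs φ) =
  (Free z φ × ¬ (z VM.∈ xs) × ¬ (z VM.∈ ys)) ⊎ (z VM.∈ us) ⊎ (z VM.∈ vs)

Closed : ∀ {s} → Formula s → Set
Closed φ = ∀ z → ¬ Free z φ

Functional : ∀ {s j} → Vec ℕ j → Vec ℕ j → Formula s → Set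
Functional {s} {j} xs ys φ =
  (g : Graph s) (ν : ℕ → Node g) (a b c : Vec (Node g) j) →
  Sat g ((ν [ xs ≔* a ]) [ ys ≔* b ]) φ →
  Sat g ((ν [ xs ≔* a ]) [ ys ≔* c ]) φ → b ≡ c

IsDTC : ∀ {s} → ℕ → Formula s → Set
IsDTC k (lab σ x)   = ⊤
IsDTC k (edg σ x y) = ⊤
IsDTC k (eq x y)    = ⊤
IsDTC k (neg φ)     = IsDTC k φ
IsDTC k (and φ ψ)   = IsDTC k φ × IsDTC k ψ
IsDTC k (or φ ψ)    = IsDTC k φ × IsDTC k ψ
IsDTC k (ex x φ)    = IsDTC k φ
IsDTC k (all x φ)   = IsDTC k φ
IsDTC k (tc j xs ys us vs φ) =
  j ≡ k × Unique (toList xs ++ toList ys) × Functional xs ys φ × IsDTC k φ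

_⊨_ : ∀ {s} → Graph s → Formula s → Set
g ⊨ φ = (ν : ℕ → Node g) → Sat g ν φ

data Test (s k nX : ℕ) : Set where
  labT     : Fin k → Fin s → Test s k nX
  pebT     : Fin k → Fin nX → Test s k nX
  inedgeT  : Fin k → Fin s → Test s k nX
  outedgeT : Fin k → Fin s → Test s k nX

data Op (s k nX : ℕ) : Set where
  inmove   : Fin k → Fin s → Op s k nX
  outmove  : Fin k → Fin s → Op s k nX
  drop     : Fin k → Fin nX → Op s k nX
  retrieve : Fin nX → Op s k nX
  test     : Test s k nX → Op s k nX
  ntest    : Test s k nX → Op s k nX

record Automaton (s k : ℕ) : Set where
  field
    nQ        : ℕ
    nX        : ℕ
    q0        : Fin nQ
    accepting : Fin nQ → Bool
    instrs    : List (Fin nQ × Op s k nX × Fin nQ)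

open Automaton public

module _ {s k : ℕ} (𝒜 : Automaton s k) (g : Graph s) where

  Heads : Set
  Heads = Vec (Node g) k

  Stack : Set
  Stack = List (Fin (nX 𝒜) × Node g)

  Config : Set
  Config = Fin (nQ 𝒜) × Heads × Stack

  Holds : Test s k (nX 𝒜) → Heads → Stack → Set
  Holds (labT i σ)     u α = nlab g (lookup u i) ≡ σ
  Holds (pebT i x)     u α = (x , lookup u i) ∈ α
  Holds (inedgeT i σ)  u α = ∃ λ e → tgt g e ≡ lookup u i × elab g e ≡ σ
  Holds (outedgeT i σ) u α = ∃ λ e → src g e ≡ lookup u i × elab g e ≡ σ

  Exec : Op s k (nX 𝒜) → Heads → Stack → Heads → Stack → Set
  Exec (inmove i σ)  u α u' α' =
    (∃ λ e → tgt g e ≡ lookup u i × elab g e ≡ σ × u' ≡ u [ i ]≔ src g e) × α' ≡ α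
  Exec (outmove i σ) u α u' α' =
    (∃ λ e → src g e ≡ lookup u i × elab g e ≡ σ × u' ≡ u [ i ]≔ tgt g e) × α' ≡ α
  Exec (drop i x)    u α u' α' =
    (∀ v → (x , v) ∉ α) × u' ≡ u × α' ≡ (x , lookup u i) ∷ α
  Exec (retrieve x)  u α u' α' =
    u' ≡ u × ∃ λ v → α ≡ (x , v) ∷ α'
  Exec (test t)      u α u' α' = Holds t u α × u' ≡ u × α' ≡ α
  Exec (ntest t)     u α u' α' = ¬ Holds t u α × u' ≡ u × α' ≡ α

  Step : Config → Config → Set
  Step (p , u , α) (q , u' , α') =
    ∃ λ χ → (p , χ , q) ∈ instrs 𝒜 × Exec χ u α u' α'

  Halting : Config → Set
  Halting c = ¬ (∃ λ c' → Step c c')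

  Acc : Node g → Set
  Acc u = ∃ λ q → ∃ λ v →
    Star Step (q0 𝒜 , replicate k u , []) (q , v , []) ×
    accepting 𝒜 q ≡ true × Halting (q , v , [])

WellFormed : ∀ {s k} → Automaton s k → Set
WellFormed {s} 𝒜 = (g : Graph s) (u₁ u₂ : Node g) → Acc 𝒜 g u₁ → Acc 𝒜 g u₂

_∈L_ : ∀ {s k} → Graph s → Automaton s k → Set
g ∈L 𝒜 = (u : Node g) → Acc 𝒜 g u

Complementary : ∀ {s k nX} → Op s k nX → Op s k nX → Set
Complementary χ₁ χ₂ = ∃ λ t → (χ₁ ≡ test t × χ₂ ≡ ntest t) ⊎ (χ₁ ≡ ntest t × χ₂ ≡ test t)

Deterministic : ∀ {s k} → Automaton s k → Set
Deterministic 𝒜 =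
  ∀ p χ₁ q₁ χ₂ q₂ → (p , χ₁ , q₁) ∈ instrs 𝒜 → (p , χ₂ , q₂) ∈ instrs 𝒜 →
  (p , χ₁ , q₁) ≢ (p , χ₂ , q₂) → Complementary χ₁ χ₂

{-# OPTIONS --safe #-}
-- Cut a run into stack-preserving steps: a move or a test, or a drop followed by a run on the
-- enlarged stack that ends with the matching retrieve. Holding the nodes under the pebbles in
-- variables, these steps between configurations (state, k head positions) are FO+DTC^k-definable by
-- induction on the nesting depth, which is at most the number of pebbles. Their reflexive-transitive
-- closure is obtained by Kleene's construction over the states: a path through t ∷ S either avoids t,
-- or reaches t, loops at t and leaves t, where the loops at t that avoid t in between are iterated by a
-- k-ary transitive closure. Since the automaton is deterministic, so are these steps, hence the first
-- return to t is a function of the heads at t and the closure is deterministic. Acceptance from a node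
-- is then a disjunction over accepting states of a run from the initial to a halting configuration.
module Submission where

open import Defs
open import Level using (0ℓ)
open import Data.Nat using (ℕ; zero; suc; _≤_; _<_; _+_; _≡ᵇ_; z≤n; s≤s)
open import Data.Nat.Properties
  using (≤-refl; ≤-reflexive; ≤-trans; <-≤-trans; <-irrefl; <⇒≢; <⇒≤; m≤m+n; m≤n⇒m≤1+n; n<1+n;
         +-suc; +-identityʳ; ≡ᵇ⇒≡; ≡⇒≡ᵇ; _≤?_; ≰⇒>)
open import Data.Bool using (true; false; T)
import Data.Bool as Bool
open import Data.Unit using (tt)
open import Data.Empty using (⊥; ⊥-elim)
open import Data.Fin using (Fin; zero; suc)
import Data.Fin.Properties as Fin
open import Data.Product using (Σ; ∃; ∃₂; _×_; _,_; proj₁; proj₂)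
import Data.Product as Product
open import Data.Product.Properties using (,-injectiveˡ; ,-injectiveʳ) renaming (≡-dec to ×-≡-dec)
open import Data.Sum using (_⊎_; inj₁; inj₂)
import Data.Sum as Sum
open import Data.Sum.Function.Propositional using (_⊎-⇔_)
open import Data.Vec using (Vec; []; _∷_; lookup; replicate; toList; _[_]≔_)
import Data.Vec.Properties as VecP
import Data.Vec.Membership.Propositional as Vec
open import Data.Vec.Membership.Propositional.Properties using () renaming (∈-lookup to ∈-lookupᵥ)
open import Data.Vec.Relation.Unary.Any using (here; there)
open import Data.List using (List; []; _∷_; _++_; length; map; allFin)
import Data.List as List
open import Data.List.Properties using (length-map)
open import Data.List.Relation.Unary.Any using (Any; here; there)
import Data.List.Relation.Unary.Any as Any
import Data.List.Relation.Unary.Any.Properties as Anyₚ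
open import Data.List.Relation.Unary.All using (All; []; _∷_)
import Data.List.Relation.Unary.All as All
open import Data.List.Relation.Unary.All.Properties using (¬Any⇒All¬)
open import Data.List.Relation.Unary.AllPairs using ([]; _∷_)
open import Data.List.Relation.Unary.Unique.Propositional using (Unique)
open import Data.List.Relation.Unary.Unique.Propositional.Properties using (allFin⁺; Unique[x∷xs]⇒x∉xs)
open import Data.List.Membership.Propositional using (_∈_; _∉_; find; lose)
open import Data.List.Membership.Propositional.Properties using (∈-allFin; ∈-lookup; ∈-map⁺)
import Data.List.Membership.DecPropositional as DecMembership
open import Relation.Nullary using (¬_; Dec; yes; no)
open import Relation.Nullary.Decidable using (decidable-stable; ¬?)
import Relation.Nullary.Decidable as Dec
open import Relation.Unary using (Pred; _⊆_; _∪_)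
open import Relation.Binary using (Rel)
import Relation.Binary.Rewriting as Rewriting
open import Relation.Binary.PropositionalEquality
  using (_≡_; _≢_; refl; sym; trans; cong; cong₂; subst; subst₂)
open import Relation.Binary.Construct.Closure.ReflexiveTransitive using (Star; ε; _◅_; _◅◅_)
import Relation.Binary.Construct.Closure.ReflexiveTransitive as Star
open import Function using (_∘_; id; case_of_)
open import Function.Bundles using (_⇔_; mk⇔; Equivalence)
import Function.Properties.Equivalence as ⇔

open Equivalence using (to; from)

range : ℕ → (j : ℕ) → Vec ℕ j
range b zero    = []
range b (suc j) = b ∷ range (suc b) j

Vars : ∀ {j} → Vec ℕ j → Pred ℕ 0ℓ
Vars xs z = z Vec.∈ xs

∈-range⇒< : ∀ b j {z} → z Vec.∈ range b j → z < b + j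
∈-range⇒< b (suc j) (here refl)    = subst (b <_) (sym (+-suc b j)) (s≤s (m≤m+n b j))
∈-range⇒< b (suc j) {z} (there z∈) = subst (z <_) (sym (+-suc b j)) (∈-range⇒< (suc b) j z∈)

∈-replicate⁻ : ∀ {j} {x z : ℕ} → z Vec.∈ replicate j x → z ≡ x
∈-replicate⁻ {suc j} (here z≡x)  = z≡x
∈-replicate⁻ {suc j} (there z∈) = ∈-replicate⁻ z∈

replicate-below : ∀ {j x b} → x < b → Vars (replicate j x) ⊆ (_< b)
replicate-below {b = b} x<b z∈ = subst (_< b) (sym (∈-replicate⁻ z∈)) x<b

range-below : ∀ {b j c} → b + j ≤ c → Vars (range b j) ⊆ (_< c)
range-below {b} {j} b+j≤c z∈ = <-≤-trans (∈-range⇒< b j z∈) b+j≤c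

below-mono : ∀ {j b c} {xs : Vec ℕ j} → b ≤ c → Vars xs ⊆ (_< b) → Vars xs ⊆ (_< c)
below-mono b≤c xs<b z∈ = <-≤-trans (xs<b z∈) b≤c

module _ {A : Set} where

  update-same : (ν : ℕ → A) (x : ℕ) (a : A) → (ν [ x ≔ a ]) x ≡ a
  update-same ν x a with x ≡ᵇ x in e
  ... | true  = refl
  ... | false with () ← subst T e (≡⇒≡ᵇ x x refl)

  update-other : (ν : ℕ → A) (x : ℕ) (a : A) {z : ℕ} → z ≢ x → (ν [ x ≔ a ]) z ≡ ν z
  update-other ν x a {z} z≢x with z ≡ᵇ x in e
  ... | true  = ⊥-elim (z≢x (≡ᵇ⇒≡ z x (subst T (sym e) tt)))
  ... | false = refl

  updates-below : ∀ (ν : ℕ → A) b j (a : Vec A j) {z} → z < b → (ν [ range b j ≔* a ]) z ≡ ν z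
  updates-below ν b zero    []       z<b = refl
  updates-below ν b (suc j) (a ∷ as) z<b =
    trans (updates-below (ν [ b ≔ a ]) (suc b) j as (m≤n⇒m≤1+n z<b)) (update-other ν b a (<⇒≢ z<b))

  mapV-updates-range : ∀ (ν : ℕ → A) b j (a : Vec A j) → mapV (ν [ range b j ≔* a ]) (range b j) ≡ a
  mapV-updates-range ν b zero    []       = refl
  mapV-updates-range ν b (suc j) (a ∷ as) =
    cong₂ _∷_ (trans (updates-below (ν [ b ≔ a ]) (suc b) j as (n<1+n b)) (update-same ν b a))
              (mapV-updates-range (ν [ b ≔ a ]) (suc b) j as)

  lookup-mapV : ∀ {j} (ν : ℕ → A) (xs : Vec ℕ j) i → lookup (mapV ν xs) i ≡ ν (lookup xs i)
  lookup-mapV ν (x ∷ xs) zero    = refl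
  lookup-mapV ν (x ∷ xs) (suc i) = lookup-mapV ν xs i

  mapV-replicate : ∀ {j} (ν : ℕ → A) x → mapV ν (replicate j x) ≡ replicate j (ν x)
  mapV-replicate {zero}  ν x = refl
  mapV-replicate {suc j} ν x = cong (ν x ∷_) (mapV-replicate ν x)

  Agree : ℕ → (ℕ → A) → (ℕ → A) → Set
  Agree b ν ν′ = ∀ {z} → z < b → ν z ≡ ν′ z

  agree-sym : ∀ {b} {ν ν′ : ℕ → A} → Agree b ν ν′ → Agree b ν′ ν
  agree-sym ν≈ν′ z<b = sym (ν≈ν′ z<b)

  agree-trans : ∀ {b} {ν₁ ν₂ ν₃ : ℕ → A} → Agree b ν₁ ν₂ → Agree b ν₂ ν₃ → Agree b ν₁ ν₃
  agree-trans ν₁≈ν₂ ν₂≈ν₃ z<b = trans (ν₁≈ν₂ z<b) (ν₂≈ν₃ z<b)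

  agree-mono : ∀ {b c} {ν ν′ : ℕ → A} → c ≤ b → Agree b ν ν′ → Agree c ν ν′
  agree-mono c≤b ν≈ν′ z<c = ν≈ν′ (<-≤-trans z<c c≤b)

  mapV-agree : ∀ {j b} {ν ν′ : ℕ → A} (xs : Vec ℕ j) → Agree b ν ν′ → Vars xs ⊆ (_< b) → mapV ν xs ≡ mapV ν′ xs
  mapV-agree []       ν≈ν′ xs<b = refl
  mapV-agree (x ∷ xs) ν≈ν′ xs<b = cong₂ _∷_ (ν≈ν′ (xs<b (here refl))) (mapV-agree xs ν≈ν′ (xs<b ∘ there))

  updates-agree : ∀ (ν : ℕ → A) {b c} j (a : Vec A j) → b ≤ c → Agree b ν (ν [ range c j ≔* a ])
  updates-agree ν j a b≤c z<b = sym (updates-below ν _ j a (<-≤-trans z<b b≤c))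

  -- definitionally the valuation that Sat uses inside tc j (range b j) (range (b + j) j) …
  updates₂ : (ℕ → A) → ℕ → (j : ℕ) → Vec A j → Vec A j → (ℕ → A)
  updates₂ ν b j a a′ = (ν [ range b j ≔* a ]) [ range (b + j) j ≔* a′ ]

  updates₂-agree : ∀ (ν : ℕ → A) b j a a′ → Agree b ν (updates₂ ν b j a a′)
  updates₂-agree ν b j a a′ =
    agree-trans (updates-agree ν j a ≤-refl) (updates-agree (ν [ range b j ≔* a ]) j a′ (m≤m+n b j))

  updates₂-fst : ∀ (ν : ℕ → A) b j a a′ → mapV (updates₂ ν b j a a′) (range b j) ≡ a
  updates₂-fst ν b j a a′ =
    trans (sym (mapV-agree (range b j) (updates-agree (ν [ range b j ≔* a ]) j a′ ≤-refl) (range-below ≤-refl)))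
          (mapV-updates-range ν b j a)

  updates₂-snd : ∀ (ν : ℕ → A) b j a a′ → mapV (updates₂ ν b j a a′) (range (b + j) j) ≡ a′
  updates₂-snd ν b j a a′ = mapV-updates-range (ν [ range b j ≔* a ]) (b + j) j a′

module _ {s : ℕ} where

  ⊤ᶠ ⊥ᶠ : Formula s
  ⊤ᶠ = all 0 (eq 0 0)
  ⊥ᶠ = neg ⊤ᶠ

  guard : ∀ {A : Set} → Dec A → Formula s → Formula s
  guard (yes _) φ = φ
  guard (no _)  φ = ⊥ᶠ

  ⋁ : ∀ {A : Set} → (A → Formula s) → List A → Formula s
  ⋁ f []       = ⊥ᶠ
  ⋁ f (a ∷ as) = or (f a) (⋁ f as)

  ∃⃗ : ∀ {j} → Vec ℕ j → Formula s → Formula s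
  ∃⃗ []       φ = φ
  ∃⃗ (x ∷ xs) φ = ex x (∃⃗ xs φ)

  eqs : ∀ {j} → Vec ℕ j → Vec ℕ j → Formula s
  eqs []       []       = ⊤ᶠ
  eqs (x ∷ xs) (y ∷ ys) = and (eq x y) (eqs xs ys)

  eqsExcept : ∀ {j} → Fin j → Vec ℕ j → Vec ℕ j → Formula s
  eqsExcept zero    (x ∷ xs) (y ∷ ys) = eqs xs ys
  eqsExcept (suc i) (x ∷ xs) (y ∷ ys) = and (eq x y) (eqsExcept i xs ys)

Valuation : ∀ {s} → Graph s → Set
Valuation g = ℕ → Node g

module _ {s : ℕ} (g : Graph s) where

  sat-⊤ᶠ : ∀ ν → Sat g ν ⊤ᶠ
  sat-⊤ᶠ ν a = refl

  ¬sat-⊥ᶠ : ∀ {ν} → ¬ Sat g ν ⊥ᶠ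
  ¬sat-⊥ᶠ {ν} h = h (sat-⊤ᶠ ν)

  guard-⇔ : ∀ {A : Set} (A? : Dec A) {φ ν} → Sat g ν (guard A? φ) ⇔ (A × Sat g ν φ)
  guard-⇔ (yes a) = mk⇔ (a ,_) proj₂
  guard-⇔ (no ¬a) {ν = ν} = mk⇔ (⊥-elim ∘ ¬sat-⊥ᶠ {ν}) (⊥-elim ∘ ¬a ∘ proj₁)

  ⋁-⇔ : ∀ {A : Set} (f : A → Formula s) as {ν} → Sat g ν (⋁ f as) ⇔ Any (λ a → Sat g ν (f a)) as
  ⋁-⇔ f []       {ν} = mk⇔ (⊥-elim ∘ ¬sat-⊥ᶠ {ν}) λ ()
  ⋁-⇔ f (a ∷ as) = mk⇔ (Sum.[ here , there ∘ to (⋁-⇔ f as) ])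
                       λ { (here h) → inj₁ h ; (there h) → inj₂ (from (⋁-⇔ f as) h) }

  ∃⃗-⇔ : ∀ {j} (zs : Vec ℕ j) φ {ν} → Sat g ν (∃⃗ zs φ) ⇔ ∃ λ a → Sat g (ν [ zs ≔* a ]) φ
  ∃⃗-⇔ []       φ = mk⇔ ([] ,_) λ { ([] , h) → h }
  ∃⃗-⇔ (z ∷ zs) φ = mk⇔ (λ { (a , h) → Product.map (a ∷_) id (to (∃⃗-⇔ zs φ) h) })
                         (λ { (a ∷ as , h) → a , from (∃⃗-⇔ zs φ) (as , h) })

  ∃⃗₂-⇔ : ∀ b j φ {ν} → Sat g ν (∃⃗ (range b j) (∃⃗ (range (b + j) j) φ)) ⇔
                        ∃₂ λ a a′ → Sat g (updates₂ ν b j a a′) φ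
  ∃⃗₂-⇔ b j φ = mk⇔ (Product.map₂ (to (∃⃗-⇔ (range (b + j) j) φ)) ∘ to (∃⃗-⇔ (range b j) _))
                   (from (∃⃗-⇔ (range b j) _) ∘ Product.map₂ (from (∃⃗-⇔ (range (b + j) j) φ)))

  eqs-⇔ : ∀ {j} (xs ys : Vec ℕ j) {ν} → Sat g ν (eqs xs ys) ⇔ (mapV ν xs ≡ mapV ν ys)
  eqs-⇔ []       []       {ν} = mk⇔ (λ _ → refl) (λ _ → sat-⊤ᶠ ν)
  eqs-⇔ (x ∷ xs) (y ∷ ys)     =
    mk⇔ (λ { (x≡y , h) → cong₂ _∷_ x≡y (to (eqs-⇔ xs ys) h) })
        (λ e → VecP.∷-injectiveˡ e , from (eqs-⇔ xs ys) (VecP.∷-injectiveʳ e))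

  eqsExcept-⇔ : ∀ {j} i (xs ys : Vec ℕ j) {ν} →
                Sat g ν (eqsExcept i xs ys) ⇔ (mapV ν ys ≡ mapV ν xs [ i ]≔ lookup (mapV ν ys) i)
  eqsExcept-⇔ zero    (x ∷ xs) (y ∷ ys) =
    mk⇔ (cong (_ ∷_) ∘ sym ∘ to (eqs-⇔ xs ys)) (from (eqs-⇔ xs ys) ∘ sym ∘ VecP.∷-injectiveʳ)
  eqsExcept-⇔ (suc i) (x ∷ xs) (y ∷ ys) =
    mk⇔ (λ { (x≡y , h) → cong₂ _∷_ (sym x≡y) (to (eqsExcept-⇔ i xs ys) h) })
        (λ e → sym (VecP.∷-injectiveˡ e) , from (eqsExcept-⇔ i xs ys) (VecP.∷-injectiveʳ e))

Fv : ∀ {s} → Formula s → Pred ℕ 0ℓ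
Fv φ z = Free z φ

module _ {s : ℕ} where

  ∉Fv-⊤ᶠ : ∀ {z} → ¬ Fv (⊤ᶠ {s}) z
  ∉Fv-⊤ᶠ (z≢0 , inj₁ z≡0) = z≢0 z≡0
  ∉Fv-⊤ᶠ (z≢0 , inj₂ z≡0) = z≢0 z≡0

  ∉Fv-⊥ᶠ : ∀ {z} → ¬ Fv (⊥ᶠ {s}) z
  ∉Fv-⊥ᶠ = ∉Fv-⊤ᶠ

  Fv-guard : ∀ {A : Set} (A? : Dec A) (φ : Formula s) → Fv (guard A? φ) ⊆ Fv φ
  Fv-guard (yes _) φ = id
  Fv-guard (no _)  φ = ⊥-elim ∘ ∉Fv-⊥ᶠ

  Fv-⋁ : ∀ {A : Set} {P : Pred ℕ 0ℓ} (f : A → Formula s) as → (∀ {a} → a ∈ as → Fv (f a) ⊆ P) → Fv (⋁ f as) ⊆ P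
  Fv-⋁ f []       f⊆P = ⊥-elim ∘ ∉Fv-⊥ᶠ
  Fv-⋁ f (a ∷ as) f⊆P = Sum.[ f⊆P (here refl) , Fv-⋁ f as (f⊆P ∘ there) ]

  Fv-∃⃗ : ∀ {j} {P : Pred ℕ 0ℓ} (zs : Vec ℕ j) (φ : Formula s) → Fv φ ⊆ P ∪ Vars zs → Fv (∃⃗ zs φ) ⊆ P
  Fv-∃⃗ []       φ φ⊆ z∈ = Sum.[ id , (λ ()) ] (φ⊆ z∈)
  Fv-∃⃗ {P = P} (x ∷ zs) φ φ⊆ (z≢x , z∈) = Sum.[ id , ⊥-elim ∘ z≢x ] (Fv-∃⃗ zs φ (shift ∘ φ⊆) z∈)
    where
      shift : P ∪ Vars (x ∷ zs) ⊆ (P ∪ (_≡ x)) ∪ Vars zs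
      shift (inj₁ p)         = inj₁ (inj₁ p)
      shift (inj₂ (here e))  = inj₁ (inj₂ e)
      shift (inj₂ (there m)) = inj₂ m

  Fv-tc : ∀ {j} {P : Pred ℕ 0ℓ} (xs ys us vs : Vec ℕ j) (φ : Formula s) → Fv φ ⊆ (P ∪ Vars xs) ∪ Vars ys →
          Vars us ⊆ P → Vars vs ⊆ P → Fv (tc j xs ys us vs φ) ⊆ P
  Fv-tc xs ys us vs φ φ⊆ us⊆ vs⊆ (inj₁ (z∈ , z∉xs , z∉ys)) =
    Sum.[ Sum.[ id , ⊥-elim ∘ z∉xs ] , ⊥-elim ∘ z∉ys ] (φ⊆ z∈)
  Fv-tc xs ys us vs φ φ⊆ us⊆ vs⊆ (inj₂ (inj₁ z∈us)) = us⊆ z∈us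
  Fv-tc xs ys us vs φ φ⊆ us⊆ vs⊆ (inj₂ (inj₂ z∈vs)) = vs⊆ z∈vs

  Fv-eqs : ∀ {j} (xs ys : Vec ℕ j) → Fv (eqs {s} xs ys) ⊆ Vars xs ∪ Vars ys
  Fv-eqs []       []       = ⊥-elim ∘ ∉Fv-⊤ᶠ
  Fv-eqs (x ∷ xs) (y ∷ ys) (inj₁ (inj₁ refl)) = inj₁ (here refl)
  Fv-eqs (x ∷ xs) (y ∷ ys) (inj₁ (inj₂ refl)) = inj₂ (here refl)
  Fv-eqs (x ∷ xs) (y ∷ ys) (inj₂ z∈)          = Sum.map there there (Fv-eqs xs ys z∈)

  Fv-eqsExcept : ∀ {j} i (xs ys : Vec ℕ j) → Fv (eqsExcept {s} i xs ys) ⊆ Vars xs ∪ Vars ys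
  Fv-eqsExcept zero    (x ∷ xs) (y ∷ ys) z∈                  = Sum.map there there (Fv-eqs xs ys z∈)
  Fv-eqsExcept (suc i) (x ∷ xs) (y ∷ ys) (inj₁ (inj₁ refl)) = inj₁ (here refl)
  Fv-eqsExcept (suc i) (x ∷ xs) (y ∷ ys) (inj₁ (inj₂ refl)) = inj₂ (here refl)
  Fv-eqsExcept (suc i) (x ∷ xs) (y ∷ ys) (inj₂ z∈)          = Sum.map there there (Fv-eqsExcept i xs ys z∈)

  dtc-guard : ∀ {k} {A : Set} (A? : Dec A) {φ : Formula s} → (A → IsDTC k φ) → IsDTC k (guard A? φ)
  dtc-guard (yes a) φ-dtc = φ-dtc a
  dtc-guard (no _)  _     = tt

  dtc-⋁ : ∀ {k} {A : Set} (f : A → Formula s) as → (∀ a → IsDTC k (f a)) → IsDTC k (⋁ f as)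
  dtc-⋁ f []       f-dtc = tt
  dtc-⋁ f (a ∷ as) f-dtc = f-dtc a , dtc-⋁ f as f-dtc

  dtc-∃⃗ : ∀ {k j} (zs : Vec ℕ j) {φ : Formula s} → IsDTC k φ → IsDTC k (∃⃗ zs φ)
  dtc-∃⃗ []       = id
  dtc-∃⃗ (z ∷ zs) = dtc-∃⃗ zs

  dtc-eqs : ∀ {k j} (xs ys : Vec ℕ j) → IsDTC k (eqs {s} xs ys)
  dtc-eqs []       []       = tt
  dtc-eqs (x ∷ xs) (y ∷ ys) = tt , dtc-eqs xs ys

  dtc-eqsExcept : ∀ {k j} i (xs ys : Vec ℕ j) → IsDTC k (eqsExcept {s} i xs ys)
  dtc-eqsExcept zero    (x ∷ xs) (y ∷ ys) = dtc-eqs xs ys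
  dtc-eqsExcept (suc i) (x ∷ xs) (y ∷ ys) = tt , dtc-eqsExcept i xs ys

range-≥ : ∀ b j → All (b ≤_) (toList (range b j))
range-≥ b zero    = []
range-≥ b (suc j) = ≤-refl ∷ All.map <⇒≤ (range-≥ (suc b) j)

unique-range : ∀ b j → Unique (toList (range b j))
unique-range b zero    = []
unique-range b (suc j) = All.map (λ b<z b≡z → <-irrefl b≡z b<z) (range-≥ (suc b) j) ∷ unique-range (suc b) j

range-++ : ∀ b j j′ → toList (range b j) ++ toList (range (b + j) j′) ≡ toList (range b (j + j′))
range-++ b zero    j′ = cong (λ c → toList (range c j′)) (+-identityʳ b)
range-++ b (suc j) j′ = cong (b ∷_) (trans (cong (λ c → toList (range (suc b) j) ++ toList (range c j′)) (+-suc b j))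
                                           (range-++ (suc b) j j′))

unique-range₂ : ∀ b j → Unique (toList (range b j) ++ toList (range (b + j) j))
unique-range₂ b j = subst Unique (sym (range-++ b j j)) (unique-range b (j + j))

module _ {Q H : Set} where

  data Path (R : Rel (Q × H) 0ℓ) (S : List Q) : Rel (Q × H) 0ℓ where
    [_]    : ∀ {c c′} → R c c′ → Path R S c c′
    _◅⟨_⟩_ : ∀ {c c′ c″} → R c c′ → proj₁ c′ ∈ S → Path R S c′ c″ → Path R S c c″

  Loop : Rel (Q × H) 0ℓ → Q → Rel H 0ℓ
  Loop R t a b = R (t , a) (t , b)

  Through : Rel (Q × H) 0ℓ → Q → Rel (Q × H) 0ℓ
  Through R t c c′ = ∃₂ λ a b → R c (t , a) × Star (Loop R t) a b × R (t , b) c′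

  module _ {R : Rel (Q × H) 0ℓ} where

    Path-widen : ∀ {S t c c′} → Path R S c c′ → Path R (t ∷ S) c c′
    Path-widen [ r ]          = [ r ]
    Path-widen (r ◅⟨ m ⟩ rs) = r ◅⟨ there m ⟩ Path-widen rs

    Path-join : ∀ {S c t a c′} → Path R S c (t , a) → t ∈ S → Path R S (t , a) c′ → Path R S c c′
    Path-join [ r ]          t∈S rs′ = r ◅⟨ t∈S ⟩ rs′
    Path-join (r ◅⟨ m ⟩ rs) t∈S rs′ = r ◅⟨ m ⟩ Path-join rs t∈S rs′

    Path⇒Star : ∀ {S c c′} → Path R S c c′ → Star R c c′
    Path⇒Star [ r ]          = r ◅ ε
    Path⇒Star (r ◅⟨ _ ⟩ rs) = r ◅ Path⇒Star rs

    Star⇒Path : ∀ {S c c′} → (∀ q → q ∈ S) → Star R c c′ → c ≡ c′ ⊎ Path R S c c′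
    Star⇒Path S-full ε = inj₁ refl
    Star⇒Path S-full (_◅_ {j = c′} r rs) with Star⇒Path S-full rs
    ... | inj₁ refl = inj₂ [ r ]
    ... | inj₂ rs′  = inj₂ (r ◅⟨ S-full (proj₁ c′) ⟩ rs′)

    -- Kleene's decomposition at the new intermediate state t
    Path-∷-⇔ : ∀ {S t c c′} → Path R (t ∷ S) c c′ ⇔ (Path R S c c′ ⊎ Through (Path R S) t c c′)
    Path-∷-⇔ {S} {t} = mk⇔ split (Sum.[ Path-widen , (λ (_ , _ , rs , loops , rs′) → join rs loops rs′) ])
      where
        split : ∀ {c c′} → Path R (t ∷ S) c c′ → Path R S c c′ ⊎ Through (Path R S) t c c′
        split [ r ] = inj₁ [ r ]
        split (_◅⟨_⟩_ {c′ = _ , a} r (here refl) rs) with split rs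
        ... | inj₁ rs′                        = inj₂ (a , a , [ r ] , ε , rs′)
        ... | inj₂ (_ , b , rs₁ , loops , rs₂) = inj₂ (a , b , [ r ] , rs₁ ◅ loops , rs₂)
        split (r ◅⟨ there m ⟩ rs) with split rs
        ... | inj₁ rs′                        = inj₁ (r ◅⟨ m ⟩ rs′)
        ... | inj₂ (a , b , rs₁ , loops , rs₂) = inj₂ (a , b , r ◅⟨ m ⟩ rs₁ , loops , rs₂)

        append-loops : ∀ {c a b} → Path R (t ∷ S) c (t , a) → Star (Loop (Path R S) t) a b →
                       Path R (t ∷ S) c (t , b)
        append-loops rs ε              = rs
        append-loops rs (loop ◅ loops) = append-loops (Path-join rs (here refl) (Path-widen loop)) loops

        join : ∀ {c a b c′} → Path R S c (t , a) → Star (Loop (Path R S) t) a b → Path R S (t , b) c′ →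
               Path R (t ∷ S) c c′
        join rs loops rs′ = Path-join (append-loops (Path-widen rs) loops) (here refl) (Path-widen rs′)

    Path-deterministic : Rewriting.Deterministic _≡_ R → ∀ {S t c a b} → t ∉ S →
                         Path R S c (t , a) → Path R S c (t , b) → a ≡ b
    Path-deterministic det t∉S [ r₁ ] [ r₂ ] = cong proj₂ (det r₁ r₂)
    Path-deterministic det t∉S [ r₁ ] (r₂ ◅⟨ m ⟩ _) with refl ← det r₁ r₂ = ⊥-elim (t∉S m)
    Path-deterministic det t∉S (r₁ ◅⟨ m ⟩ _) [ r₂ ] with refl ← det r₁ r₂ = ⊥-elim (t∉S m)
    Path-deterministic det t∉S (r₁ ◅⟨ _ ⟩ rs₁) (r₂ ◅⟨ _ ⟩ rs₂) with refl ← det r₁ r₂ =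
      Path-deterministic det t∉S rs₁ rs₂

  Path-map : ∀ {R R′ : Rel (Q × H) 0ℓ} {S c c′} → (∀ {x y} → R x y → R′ x y) → Path R S c c′ → Path R′ S c c′
  Path-map f [ r ]          = [ f r ]
  Path-map f (r ◅⟨ m ⟩ rs) = f r ◅⟨ m ⟩ Path-map f rs

-- φ p q xs ys b speaks about the configurations (p, xs) and (q, ys); the variables it binds are all ≥ b.
StepFormula : ℕ → ℕ → ℕ → Set
StepFormula s k n = Fin n → Fin n → Vec ℕ k → Vec ℕ k → ℕ → Formula s

-- a relation on configurations (state, heads); the valuation supplies the nodes under the pebbles
ConfRel : ∀ {s} → Graph s → ℕ → ℕ → Set₁
ConfRel g n k = Valuation g → Rel (Fin n × Vec (Node g) k) 0ℓ

module _ {s k n : ℕ} where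

  Local : (g : Graph s) → ℕ → ConfRel g n k → Set
  Local g c R = ∀ {ν ν′} → Agree c ν ν′ → ∀ {x y} → R ν x y → R ν′ x y

  Defines : (g : Graph s) → StepFormula s k n → ℕ → ConfRel g n k → Set
  Defines g φ c R = ∀ {p q xs ys b ν} → c ≤ b → Vars xs ⊆ (_< b) → Vars ys ⊆ (_< b) →
                    Sat g ν (φ p q xs ys b) ⇔ R ν (p , mapV ν xs) (q , mapV ν ys)

  Scoped : StepFormula s k n → Pred ℕ 0ℓ → Set₁
  Scoped φ V = ∀ {P : Pred ℕ 0ℓ} {p q xs ys b} → V ⊆ P → Vars xs ⊆ P → Vars ys ⊆ P → Fv (φ p q xs ys b) ⊆ P

  InDTC : StepFormula s k n → ℕ → Set
  InDTC φ c = ∀ {p q xs ys b} → c ≤ b → Vars xs ⊆ (_< b) → Vars ys ⊆ (_< b) → IsDTC k (φ p q xs ys b)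

  module _ {g : Graph s} {φ : StepFormula s k n} {c : ℕ} {R : ConfRel g n k} where

    defines-at : Local g c R → Defines g φ c R →
                 ∀ {p q xs ys b ν ν′ u u′} → c ≤ b → Vars xs ⊆ (_< b) → Vars ys ⊆ (_< b) →
                 Agree c ν ν′ → mapV ν′ xs ≡ u → mapV ν′ ys ≡ u′ →
                 Sat g ν′ (φ p q xs ys b) ⇔ R ν (p , u) (q , u′)
    defines-at loc def c≤b xs<b ys<b ν≈ν′ refl refl =
      mk⇔ (loc (agree-sym ν≈ν′) ∘ to (def c≤b xs<b ys<b)) (from (def c≤b xs<b ys<b) ∘ loc ν≈ν′)

  defines⇒functional : {R : (g : Graph s) → ConfRel g n k} {φ : StepFormula s k n} {c : ℕ} →
                       (∀ g → Local g c (R g)) → (∀ g → Defines g φ c (R g)) →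
                       ∀ t → (∀ g ν → Rewriting.Deterministic _≡_ (Loop (R g ν) t)) →
                       ∀ {b b′} → c ≤ b → b + k + k ≤ b′ →
                       Functional (range b k) (range (b + k) k) (φ t t (range b k) (range (b + k) k) b′)
  defines⇒functional {R} {φ} {c} loc def t det {b} {b′} c≤b b+2k≤b′ g ν a a₁ a₂ h₁ h₂ =
    det g ν (to (loop a₁) h₁) (to (loop a₂) h₂)
    where
      b+k≤b′ : b + k ≤ b′
      b+k≤b′ = ≤-trans (m≤m+n (b + k) k) b+2k≤b′

      loop : ∀ a′ → Sat g (updates₂ ν b k a a′) (φ t t (range b k) (range (b + k) k) b′) ⇔
                    R g ν (t , a) (t , a′)
      loop a′ = defines-at (loc g) (def g) (≤-trans c≤b (≤-trans (m≤m+n b k) b+k≤b′))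
                  (range-below b+k≤b′) (range-below b+2k≤b′) (agree-mono c≤b (updates₂-agree ν b k a a′))
                  (updates₂-fst ν b k a a′) (updates₂-snd ν b k a a′)

module Kleene {s k n : ℕ} where

  _⁺ : ℕ → ℕ
  b ⁺ = b + k

  z₁ z₂ z₃ z₄ : ℕ → Vec ℕ k
  z₁ b = range b k
  z₂ b = range (b ⁺) k
  z₃ b = range (b ⁺ ⁺) k
  z₄ b = range (b ⁺ ⁺ ⁺) k

  above : ℕ → ℕ
  above b = b ⁺ ⁺ ⁺ ⁺

  throughBody : StepFormula s k n → Fin n → StepFormula s k n
  throughBody ψ t p r xs ys b =
    and (ψ p t xs (z₁ b) (above b))
        (and (tc k (z₃ b) (z₄ b) (z₁ b) (z₂ b) (ψ t t (z₃ b) (z₄ b) (above b)))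
             (ψ t r (z₂ b) ys (above b)))

  throughF : StepFormula s k n → Fin n → StepFormula s k n
  throughF ψ t p r xs ys b = ∃⃗ (z₁ b) (∃⃗ (z₂ b) (throughBody ψ t p r xs ys b))

  kleeneF : StepFormula s k n → List (Fin n) → StepFormula s k n
  kleeneF φ []      = φ
  kleeneF φ (t ∷ S) p r xs ys b = or (kleeneF φ S p r xs ys b) (throughF (kleeneF φ S) t p r xs ys b)

  reachF : StepFormula s k n → StepFormula s k n
  reachF φ p r xs ys b = or (guard (p Fin.≟ r) (eqs xs ys)) (kleeneF φ (allFin n) p r xs ys b)

  private
    ≤-⁺ : ∀ {a b} → a ≤ b → a ≤ b ⁺
    ≤-⁺ {b = b} a≤b = ≤-trans a≤b (m≤m+n b k)

    b≤above : ∀ {b} → b ≤ above b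
    b≤above = ≤-⁺ (≤-⁺ (≤-⁺ (≤-⁺ ≤-refl)))

    z₁<above : ∀ {b} → Vars (z₁ b) ⊆ (_< above b)
    z₁<above = range-below (≤-⁺ (≤-⁺ (≤-⁺ ≤-refl)))

    z₂<above : ∀ {b} → Vars (z₂ b) ⊆ (_< above b)
    z₂<above = range-below (≤-⁺ (≤-⁺ ≤-refl))

    z₃<above : ∀ {b} → Vars (z₃ b) ⊆ (_< above b)
    z₃<above = range-below (≤-⁺ ≤-refl)

    z₄<above : ∀ {b} → Vars (z₄ b) ⊆ (_< above b)
    z₄<above = range-below ≤-refl

  module _ {g : Graph s} {c : ℕ} where

    throughF-defines : ∀ {R : ConfRel g n k} {ψ} → Local g c R → Defines g ψ c R →
                       ∀ t → Defines g (throughF ψ t) c (λ ν → Through (R ν) t)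
    throughF-defines {R} {ψ} loc def t {p} {r} {xs} {ys} {b} {ν} c≤b xs<b ys<b =
      mk⇔ (λ h → let a₁ , a₂ , h₁ , h₂ , h₃ = to blocks h
                 in a₁ , a₂ , to (first a₁ a₂) h₁ , to (loops a₁ a₂) h₂ , to (last a₁ a₂) h₃)
          (λ (a₁ , a₂ , r₁ , r₂ , r₃) →
             from blocks (a₁ , a₂ , from (first a₁ a₂) r₁ , from (loops a₁ a₂) r₂ , from (last a₁ a₂) r₃))
      where
        blocks : Sat g ν (throughF ψ t p r xs ys b) ⇔
                 ∃₂ λ a₁ a₂ → Sat g (updates₂ ν b k a₁ a₂) (throughBody ψ t p r xs ys b)
        blocks = ∃⃗₂-⇔ g b k (throughBody ψ t p r xs ys b)

        c≤above : c ≤ above b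
        c≤above = ≤-trans c≤b b≤above

        module _ (a₁ a₂ : Vec (Node g) k) where
          ν₂ : Valuation g
          ν₂ = updates₂ ν b k a₁ a₂

          ν≈ν₂ : Agree c ν ν₂
          ν≈ν₂ = agree-mono c≤b (updates₂-agree ν b k a₁ a₂)

          first : Sat g ν₂ (ψ p t xs (z₁ b) (above b)) ⇔ R ν (p , mapV ν xs) (t , a₁)
          first = defines-at loc def c≤above (below-mono b≤above xs<b) z₁<above ν≈ν₂
                    (sym (mapV-agree xs (updates₂-agree ν b k a₁ a₂) xs<b)) (updates₂-fst ν b k a₁ a₂)

          last : Sat g ν₂ (ψ t r (z₂ b) ys (above b)) ⇔ R ν (t , a₂) (r , mapV ν ys)
          last = defines-at loc def c≤above z₂<above (below-mono b≤above ys<b) ν≈ν₂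
                   (updates₂-snd ν b k a₁ a₂) (sym (mapV-agree ys (updates₂-agree ν b k a₁ a₂) ys<b))

          loop : ∀ {a a′} → Sat g (updates₂ ν₂ (b ⁺ ⁺) k a a′) (ψ t t (z₃ b) (z₄ b) (above b)) ⇔
                            R ν (t , a) (t , a′)
          loop {a} {a′} = defines-at loc def c≤above z₃<above z₄<above
                            (agree-trans ν≈ν₂ (agree-mono (≤-⁺ (≤-⁺ c≤b)) (updates₂-agree ν₂ (b ⁺ ⁺) k a a′)))
                            (updates₂-fst ν₂ (b ⁺ ⁺) k a a′) (updates₂-snd ν₂ (b ⁺ ⁺) k a a′)

          loops : Sat g ν₂ (tc k (z₃ b) (z₄ b) (z₁ b) (z₂ b) (ψ t t (z₃ b) (z₄ b) (above b))) ⇔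
                  Star (Loop (R ν) t) a₁ a₂
          loops = mk⇔ (subst₂ (Star (Loop (R ν) t)) ends₁ ends₂ ∘ Star.map (to loop))
                      (Star.map (from loop) ∘ subst₂ (Star (Loop (R ν) t)) (sym ends₁) (sym ends₂))
            where
              ends₁ : mapV ν₂ (z₁ b) ≡ a₁
              ends₁ = updates₂-fst ν b k a₁ a₂

              ends₂ : mapV ν₂ (z₂ b) ≡ a₂
              ends₂ = updates₂-snd ν b k a₁ a₂

    Path-local : ∀ {R : ConfRel g n k} {S} → Local g c R → Local g c (λ ν → Path (R ν) S)
    Path-local loc ν≈ν′ = Path-map (loc ν≈ν′)

    kleeneF-defines : ∀ {R : ConfRel g n k} {φ} → Local g c R → Defines g φ c R →
                      ∀ S → Defines g (kleeneF φ S) c (λ ν → Path (R ν) S)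
    kleeneF-defines loc def [] c≤b xs<b ys<b =
      mk⇔ ([_] ∘ to (def c≤b xs<b ys<b)) λ { [ r ] → from (def c≤b xs<b ys<b) r ; (_ ◅⟨ () ⟩ _) }
    kleeneF-defines {R} {φ} loc def (t ∷ S) c≤b xs<b ys<b =
      ⇔.trans (IH c≤b xs<b ys<b ⊎-⇔ throughF-defines (Path-local loc) IH t c≤b xs<b ys<b) (⇔.sym Path-∷-⇔)
      where
        IH : Defines g (kleeneF φ S) c (λ ν → Path (R ν) S)
        IH = kleeneF-defines loc def S

    reachF-defines : ∀ {R : ConfRel g n k} {φ} → Local g c R → Defines g φ c R →
                     Defines g (reachF φ) c (λ ν → Star (R ν))
    reachF-defines {R} {φ} loc def {p} {r} {xs} {ys} {b} {ν} c≤b xs<b ys<b = mk⇔ sound complete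
      where
        paths : Sat g ν (kleeneF φ (allFin n) p r xs ys b) ⇔ Path (R ν) (allFin n) (p , mapV ν xs) (r , mapV ν ys)
        paths = kleeneF-defines loc def (allFin n) c≤b xs<b ys<b

        sound : Sat g ν (reachF φ p r xs ys b) → Star (R ν) (p , mapV ν xs) (r , mapV ν ys)
        sound (inj₁ h) with refl , xs≡ys ← to (guard-⇔ g (p Fin.≟ r)) h =
          subst (λ u → Star (R ν) (p , mapV ν xs) (p , u)) (to (eqs-⇔ g xs ys) xs≡ys) ε
        sound (inj₂ h) = Path⇒Star (to paths h)

        complete : Star (R ν) (p , mapV ν xs) (r , mapV ν ys) → Sat g ν (reachF φ p r xs ys b)
        complete rs with Star⇒Path ∈-allFin rs
        ... | inj₁ c≡c′ =
          inj₁ (from (guard-⇔ g (p Fin.≟ r)) (,-injectiveˡ c≡c′ , from (eqs-⇔ g xs ys) (,-injectiveʳ c≡c′)))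
        ... | inj₂ rs′  = inj₂ (from paths rs′)

  throughF-scoped : ∀ {ψ V} → Scoped ψ V → ∀ t → Scoped (throughF ψ t) V
  throughF-scoped {ψ} sc t {P} {p} {r} {xs} {ys} {b} V⊆P xs⊆P ys⊆P =
    Fv-∃⃗ (z₁ b) (∃⃗ (z₂ b) (throughBody ψ t p r xs ys b)) (Fv-∃⃗ (z₂ b) (throughBody ψ t p r xs ys b) body)
    where
      P′ : Pred ℕ 0ℓ
      P′ = (P ∪ Vars (z₁ b)) ∪ Vars (z₂ b)

      P⊆P′ : P ⊆ P′
      P⊆P′ = inj₁ ∘ inj₁

      loop : Fv (ψ t t (z₃ b) (z₄ b) (above b)) ⊆ (P′ ∪ Vars (z₃ b)) ∪ Vars (z₄ b)
      loop = sc {p = t} {t} {b = above b} (inj₁ ∘ inj₁ ∘ P⊆P′ ∘ V⊆P) (inj₁ ∘ inj₂) inj₂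

      body : Fv (throughBody ψ t p r xs ys b) ⊆ P′
      body (inj₁ z∈)        = sc {p = p} {t} {b = above b} (P⊆P′ ∘ V⊆P) (P⊆P′ ∘ xs⊆P) (inj₁ ∘ inj₂) z∈
      body (inj₂ (inj₁ z∈)) =
        Fv-tc {P = P′} (z₃ b) (z₄ b) (z₁ b) (z₂ b) (ψ t t (z₃ b) (z₄ b) (above b)) loop (inj₁ ∘ inj₂) inj₂ z∈
      body (inj₂ (inj₂ z∈)) = sc {p = t} {r} {b = above b} (P⊆P′ ∘ V⊆P) inj₂ (P⊆P′ ∘ ys⊆P) z∈

  kleeneF-scoped : ∀ {φ V} → Scoped φ V → ∀ S → Scoped (kleeneF φ S) V
  kleeneF-scoped sc []      = sc
  kleeneF-scoped {φ} sc (t ∷ S) {p = p} {r} {b = b} V⊆P xs⊆P ys⊆P =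
    Sum.[ kleeneF-scoped sc S {p = p} {r} {b = b} V⊆P xs⊆P ys⊆P
        , throughF-scoped {kleeneF φ S} (kleeneF-scoped sc S) t {p = p} {r} {b = b} V⊆P xs⊆P ys⊆P ]

  reachF-scoped : ∀ {φ V} → Scoped φ V → Scoped (reachF φ) V
  reachF-scoped {φ} sc {p = p} {r} {xs} {ys} {b} V⊆P xs⊆P ys⊆P =
    Sum.[ Sum.[ xs⊆P , ys⊆P ] ∘ Fv-eqs xs ys ∘ Fv-guard (p Fin.≟ r) (eqs xs ys)
        , kleeneF-scoped sc (allFin n) {p = p} {r} {b = b} V⊆P xs⊆P ys⊆P ]

  throughF-dtc : ∀ {ψ c} t → InDTC ψ c →
                 (∀ {b} → c ≤ b → Functional (z₃ b) (z₄ b) (ψ t t (z₃ b) (z₄ b) (above b))) →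
                 InDTC (throughF ψ t) c
  throughF-dtc {c = c} t dtc loops-functional {b = b} c≤b xs<b ys<b =
    dtc-∃⃗ (z₁ b) (dtc-∃⃗ (z₂ b)
      ( dtc c≤above (below-mono b≤above xs<b) z₁<above
      , (refl , unique-range₂ (b ⁺ ⁺) k , loops-functional c≤b , dtc c≤above z₃<above z₄<above)
      , dtc c≤above z₂<above (below-mono b≤above ys<b)))
    where
      c≤above : c ≤ above b
      c≤above = ≤-trans c≤b b≤above

  module _ {R : (g : Graph s) → ConfRel g n k} {φ : StepFormula s k n} {c : ℕ}
           (loc : ∀ g → Local g c (R g)) (def : ∀ g → Defines g φ c (R g))
           (det : ∀ g ν → Rewriting.Deterministic _≡_ (R g ν)) (dtc : InDTC φ c) where

    -- the loops at t that avoid t in between are functional because R is deterministic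
    kleeneF-dtc : ∀ S → Unique S → InDTC (kleeneF φ S) c
    kleeneF-dtc []      _              = dtc
    kleeneF-dtc (t ∷ S) (t≢S ∷ S-uniq) c≤b xs<b ys<b =
      kleeneF-dtc S S-uniq c≤b xs<b ys<b ,
      throughF-dtc {kleeneF φ S} t (kleeneF-dtc S S-uniq)
        (λ c≤b′ → defines⇒functional (λ g → Path-local {g = g} {c = c} {S = S} (loc g))
                    (λ g → kleeneF-defines (loc g) (def g) S) t
                    (λ g ν → Path-deterministic (det g ν) (Unique[x∷xs]⇒x∉xs (t≢S ∷ S-uniq)))
                    (≤-⁺ (≤-⁺ c≤b′)) ≤-refl)
        c≤b xs<b ys<b

    reachF-dtc : InDTC (reachF φ) c
    reachF-dtc {p = p} {r} {xs} {ys} c≤b xs<b ys<b =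
      dtc-guard (p Fin.≟ r) (λ _ → dtc-eqs xs ys) , kleeneF-dtc (allFin n) (allFin⁺ n) c≤b xs<b ys<b

lookup-injective : ∀ {A : Set} {as : List A} → Unique as → ∀ {i j} → List.lookup as i ≡ List.lookup as j → i ≡ j
lookup-injective (_ ∷ _)      {zero}  {zero}  _ = refl
lookup-injective (a∉as ∷ _)   {zero}  {suc j} e = ⊥-elim (All.lookup a∉as (∈-lookup j) e)
lookup-injective (a∉as ∷ _)   {suc i} {zero}  e = ⊥-elim (All.lookup a∉as (∈-lookup i) (sym e))
lookup-injective (_ ∷ uniq)   {suc i} {suc j} e = cong suc (lookup-injective uniq e)

unique-length : ∀ {m} {as : List (Fin m)} → Unique as → length as ≤ m
unique-length {m} {as} uniq with length as ≤? m
... | yes ≤m = ≤m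
... | no  ≰m with i , j , i<j , e ← Fin.pigeonhole (≰⇒> ≰m) (List.lookup as) =
  ⊥-elim (Fin.<-irrefl (lookup-injective uniq e) i<j)

module Macro {s k : ℕ} (𝒜 : Automaton s k) (g : Graph s) where

  Conf : Set
  Conf = Fin (nQ 𝒜) × Heads 𝒜 g

  data Simple : Op s k (nX 𝒜) → Set where
    inmove  : ∀ {i σ} → Simple (inmove i σ)
    outmove : ∀ {i σ} → Simple (outmove i σ)
    test    : ∀ {t} → Simple (test t)
    ntest   : ∀ {t} → Simple (ntest t)

  data MacroStep (α : Stack 𝒜 g) : Rel Conf 0ℓ where
    simple : ∀ {p q u u′ χ} → (p , χ , q) ∈ instrs 𝒜 → Simple χ → Exec 𝒜 g χ u α u′ α →
             MacroStep α (p , u) (q , u′)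
    nested : ∀ {p p′ r q u u′ i x} → (p , drop i x , p′) ∈ instrs 𝒜 → (∀ v → (x , v) ∉ α) →
             Star (MacroStep ((x , lookup u i) ∷ α)) (p′ , u) (r , u′) → (r , retrieve x , q) ∈ instrs 𝒜 →
             MacroStep α (p , u) (q , u′)

  mutual
    macroStep⇒steps : ∀ {α p q u u′} → MacroStep α (p , u) (q , u′) → Star (Step 𝒜 g) (p , u , α) (q , u′ , α)
    macroStep⇒steps (simple ι _ exec) = (_ , ι , exec) ◅ ε
    macroStep⇒steps (nested {u = u} {i = i} ιd x-free run ιr) =
      (_ , ιd , x-free , refl , refl) ◅ macroSteps⇒steps run ◅◅ ((_ , ιr , refl , lookup u i , refl) ◅ ε)

    macroSteps⇒steps : ∀ {α p q u u′} → Star (MacroStep α) (p , u) (q , u′) → Star (Step 𝒜 g) (p , u , α) (q , u′ , α)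
    macroSteps⇒steps ε                        = ε
    macroSteps⇒steps (_◅_ {j = _ , _} m run) = macroStep⇒steps m ◅◅ macroSteps⇒steps run

  -- Frames c₀ α c: a run from c₀ that has dropped the pebbles of α and not yet retrieved them, each
  -- pending drop recorded with the MacroStep run before it; c is where the innermost frame starts
  data Frames (c₀ : Conf) : Stack 𝒜 g → Conf → Set where
    top  : Frames c₀ [] c₀
    push : ∀ {α c p u p′ i x} → Frames c₀ α c → Star (MacroStep α) c (p , u) → (p , drop i x , p′) ∈ instrs 𝒜 →
           (∀ v → (x , v) ∉ α) → Frames c₀ ((x , lookup u i) ∷ α) (p′ , u)

  private
    _◅ʳ_ : ∀ {α c d e} → Star (MacroStep α) c d → MacroStep α d e → Star (MacroStep α) c e
    run ◅ʳ m = run ◅◅ (m ◅ ε)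

  frames⇒macroSteps : ∀ {c₀ α c p u q v} → Frames c₀ α c → Star (MacroStep α) c (p , u) →
                  Star (Step 𝒜 g) (p , u , α) (q , v , []) → Star (MacroStep []) c₀ (q , v)
  frames⇒macroSteps top run ε = run
  frames⇒macroSteps fs run ((inmove i σ , ι , exec , refl) ◅ rest) =
    frames⇒macroSteps fs (run ◅ʳ simple ι inmove (exec , refl)) rest
  frames⇒macroSteps fs run ((outmove i σ , ι , exec , refl) ◅ rest) =
    frames⇒macroSteps fs (run ◅ʳ simple ι outmove (exec , refl)) rest
  frames⇒macroSteps fs run ((test t , ι , h , refl , refl) ◅ rest) =
    frames⇒macroSteps fs (run ◅ʳ simple ι test (h , refl , refl)) rest
  frames⇒macroSteps fs run ((ntest t , ι , h , refl , refl) ◅ rest) =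
    frames⇒macroSteps fs (run ◅ʳ simple ι ntest (h , refl , refl)) rest
  frames⇒macroSteps fs run ((drop i x , ι , x-free , refl , refl) ◅ rest) =
    frames⇒macroSteps (push fs run ι x-free) ε rest
  frames⇒macroSteps (push fs run₀ ιd x-free) run ((retrieve x , ι , refl , v , refl) ◅ rest) =
    frames⇒macroSteps fs (run₀ ◅ʳ nested ιd x-free run ι) rest

  steps⇒macroSteps : ∀ {p u q v} → Star (Step 𝒜 g) (p , u , []) (q , v , []) → Star (MacroStep []) (p , u) (q , v)
  steps⇒macroSteps = frames⇒macroSteps top ε

  simple-deterministic : ∀ {χ u α u₁ u₂} → Simple χ → Exec 𝒜 g χ u α u₁ α → Exec 𝒜 g χ u α u₂ α → u₁ ≡ u₂
  simple-deterministic inmove ((e₁ , t₁ , l₁ , refl) , _) ((e₂ , t₂ , l₂ , refl) , _)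
    with refl ← in-det g e₁ e₂ (trans t₁ (sym t₂)) (trans l₁ (sym l₂)) = refl
  simple-deterministic outmove ((e₁ , s₁ , l₁ , refl) , _) ((e₂ , s₂ , l₂ , refl) , _)
    with refl ← out-det g e₁ e₂ (trans s₁ (sym s₂)) (trans l₁ (sym l₂)) = refl
  simple-deterministic test  (_ , refl , _) (_ , refl , _) = refl
  simple-deterministic ntest (_ , refl , _) (_ , refl , _) = refl

  complementary⇒simple : ∀ {χ₁ χ₂} → Complementary χ₁ χ₂ → Simple χ₁ × Simple χ₂
  complementary⇒simple (t , inj₁ (refl , refl)) = test , ntest
  complementary⇒simple (t , inj₂ (refl , refl)) = ntest , test

  complementary-exclusive : ∀ {χ₁ χ₂ u α u₁ α₁ u₂ α₂} → Complementary χ₁ χ₂ →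
                            Exec 𝒜 g χ₁ u α u₁ α₁ → Exec 𝒜 g χ₂ u α u₂ α₂ → ⊥
  complementary-exclusive (t , inj₁ (refl , refl)) (h , _) (¬h , _) = ¬h h
  complementary-exclusive (t , inj₂ (refl , refl)) (¬h , _) (h , _) = ¬h h

  module Determinism (det : Deterministic 𝒜) where

    -- Deterministic only constrains distinct instructions and instruction equality is not decided
    -- here, hence ¬¬; decidable-stable removes it for decidable goals
    same-or-complementary : ∀ {p χ₁ q₁ χ₂ q₂} → (p , χ₁ , q₁) ∈ instrs 𝒜 → (p , χ₂ , q₂) ∈ instrs 𝒜 →
                            ¬ ¬ ((χ₁ ≡ χ₂ × q₁ ≡ q₂) ⊎ Complementary χ₁ χ₂)
    same-or-complementary {p} {χ₁} {q₁} {χ₂} {q₂} ι₁ ι₂ k =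
      k (inj₂ (det p χ₁ q₁ χ₂ q₂ ι₁ ι₂ λ { refl → k (inj₁ (refl , refl)) }))

    only-instruction : ∀ {p χ₁ q₁ χ₂ q₂} → (p , χ₁ , q₁) ∈ instrs 𝒜 → ¬ Simple χ₁ → (p , χ₂ , q₂) ∈ instrs 𝒜 →
                       ¬ ¬ (χ₁ ≡ χ₂ × q₁ ≡ q₂)
    only-instruction ι₁ ¬simple ι₂ k =
      same-or-complementary ι₁ ι₂ Sum.[ k , ¬simple ∘ proj₁ ∘ complementary⇒simple ]

    Retrieving : Conf → Set
    Retrieving (r , u) = ∃₂ λ x q → (r , retrieve x , q) ∈ instrs 𝒜

    retrieving-stuck : ∀ {α c c′} → Retrieving c → ¬ MacroStep α c c′
    retrieving-stuck (x , q , ιr) (simple ι sm _) = only-instruction ιr (λ ()) ι λ { (refl , _) → case sm of λ () }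
    retrieving-stuck (x , q , ιr) (nested ιd _ _ _) = only-instruction ιr (λ ()) ιd λ { (() , _) }

    conf-≟ : (c c′ : Conf) → Dec (c ≡ c′)
    conf-≟ = ×-≡-dec Fin._≟_ (VecP.≡-dec Fin._≟_)

    mutual
      macroStep-deterministic : ∀ {α} → Rewriting.Deterministic _≡_ (MacroStep α)
      macroStep-deterministic {x = c} {c₁} {c₂} (simple ι₁ s₁ e₁) (simple ι₂ s₂ e₂) =
        decidable-stable (conf-≟ c₁ c₂) λ k → same-or-complementary ι₁ ι₂ λ
          { (inj₁ (refl , refl)) → k (cong (_ ,_) (simple-deterministic s₁ e₁ e₂))
          ; (inj₂ comp)          → complementary-exclusive comp e₁ e₂ }
      macroStep-deterministic (simple ι₁ s₁ _) (nested ι₂ _ _ _) =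
        ⊥-elim (only-instruction ι₂ (λ ()) ι₁ λ { (refl , _) → case s₁ of λ () })
      macroStep-deterministic (nested ι₁ _ _ _) (simple ι₂ s₂ _) =
        ⊥-elim (only-instruction ι₁ (λ ()) ι₂ λ { (refl , _) → case s₂ of λ () })
      macroStep-deterministic {x = c} {c₁} {c₂} (nested ι₁ _ run₁ ιr₁) (nested ι₂ _ run₂ ιr₂) =
        decidable-stable (conf-≟ c₁ c₂) λ k → only-instruction ι₁ (λ ()) ι₂ λ
          { (refl , refl) → k (nested-deterministic run₁ run₂ ιr₁ ιr₂) }

      nested-deterministic : ∀ {β c r₁ r₂ u₁ u₂ x q₁ q₂} →
                             Star (MacroStep β) c (r₁ , u₁) → Star (MacroStep β) c (r₂ , u₂) →
                             (r₁ , retrieve x , q₁) ∈ instrs 𝒜 → (r₂ , retrieve x , q₂) ∈ instrs 𝒜 →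
                             (q₁ , u₁) ≡ (q₂ , u₂)
      nested-deterministic {x = x} {q₁} {q₂} run₁ run₂ ιr₁ ιr₂
        with refl ← maximal-runs-deterministic run₁ run₂ (x , q₁ , ιr₁) (x , q₂ , ιr₂) =
        decidable-stable (conf-≟ _ _) λ k → only-instruction ιr₁ (λ ()) ιr₂ λ { (_ , refl) → k refl }

      maximal-runs-deterministic : ∀ {β c d₁ d₂} → Star (MacroStep β) c d₁ → Star (MacroStep β) c d₂ →
                                   Retrieving d₁ → Retrieving d₂ → d₁ ≡ d₂
      maximal-runs-deterministic ε          ε          _  _  = refl
      maximal-runs-deterministic ε          (m ◅ _)    r₁ _  = ⊥-elim (retrieving-stuck r₁ m)
      maximal-runs-deterministic (m ◅ _)    ε          _  r₂ = ⊥-elim (retrieving-stuck r₂ m)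
      maximal-runs-deterministic (m₁ ◅ ms₁) (m₂ ◅ ms₂) r₁ r₂ with refl ← macroStep-deterministic m₁ m₂ =
        maximal-runs-deterministic ms₁ ms₂ r₁ r₂

module Formulas {s k : ℕ} (𝒜 : Automaton s k) where

  open Kleene {s} {k} {nQ 𝒜} using (reachF)
  open DecMembership (Fin._≟_ {nX 𝒜}) using (_∈?_)

  State : Set
  State = Fin (nQ 𝒜)

  Pebble : Set
  Pebble = Fin (nX 𝒜)

  -- the pebble stack, with each node represented by a variable
  SymStack : Set
  SymStack = List (Pebble × ℕ)

  pebbles : SymStack → List Pebble
  pebbles = map proj₁

  StackVars : SymStack → Pred ℕ 0ℓ
  StackVars w z = z ∈ map proj₂ w

  testF : SymStack → Test s k (nX 𝒜) → Vec ℕ k → ℕ → Formula s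
  testF w (labT i σ)     xs b = lab σ (lookup xs i)
  testF w (pebT i x)     xs b = ⋁ (λ (y , z) → guard (x Fin.≟ y) (eq z (lookup xs i))) w
  testF w (inedgeT i σ)  xs b = ex b (edg σ b (lookup xs i))
  testF w (outedgeT i σ) xs b = ex b (edg σ (lookup xs i) b)

  simpleF : SymStack → Op s k (nX 𝒜) → Vec ℕ k → Vec ℕ k → ℕ → Formula s
  simpleF w (inmove i σ)  xs ys b = and (edg σ (lookup ys i) (lookup xs i)) (eqsExcept i xs ys)
  simpleF w (outmove i σ) xs ys b = and (edg σ (lookup xs i) (lookup ys i)) (eqsExcept i xs ys)
  simpleF w (test t)      xs ys b = and (testF w t xs b) (eqs xs ys)
  simpleF w (ntest t)     xs ys b = and (neg (testF w t xs b)) (eqs xs ys)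
  simpleF w (drop _ _)    xs ys b = ⊥ᶠ
  simpleF w (retrieve _)  xs ys b = ⊥ᶠ

  retrieve? : (x : Pebble) (χ : Op s k (nX 𝒜)) → Dec (χ ≡ retrieve x)
  retrieve? x (retrieve y)  = Dec.map′ (cong retrieve) (λ { refl → refl }) (y Fin.≟ x)
  retrieve? x (inmove _ _)  = no λ ()
  retrieve? x (outmove _ _) = no λ ()
  retrieve? x (drop _ _)    = no λ ()
  retrieve? x (test _)      = no λ ()
  retrieve? x (ntest _)     = no λ ()

  -- d bounds the nesting depth of drops; nX 𝒜 suffices since nested pebbles are distinct
  mutual
    macroF : ℕ → SymStack → StepFormula s k (nQ 𝒜)
    macroF d w p q xs ys b = ⋁ (instrF d w p q xs ys b) (instrs 𝒜)

    instrF : ℕ → SymStack → State → State → Vec ℕ k → Vec ℕ k → ℕ → State × Op s k (nX 𝒜) × State → Formula s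
    instrF d w p q xs ys b (p′ , χ , q′) = guard (p Fin.≟ p′) (opF χ d w q′ q xs ys b)

    opF : Op s k (nX 𝒜) → ℕ → SymStack → State → State → Vec ℕ k → Vec ℕ k → ℕ → Formula s
    opF (drop i x) zero    w q′ q xs ys b = ⊥ᶠ
    opF (drop i x) (suc d) w q′ q xs ys b =
      guard (¬? (x ∈? pebbles w)) (⋁ (retrieveF d ((x , lookup xs i) ∷ w) x q′ q xs ys b) (instrs 𝒜))
    opF χ          d       w q′ q xs ys b = guard (q′ Fin.≟ q) (simpleF w χ xs ys b)

    retrieveF : ℕ → SymStack → Pebble → State → State → Vec ℕ k → Vec ℕ k → ℕ →
                State × Op s k (nX 𝒜) × State → Formula s
    retrieveF d w x q′ q xs ys b (r , χ , q″) =
      guard (retrieve? x χ) (guard (q″ Fin.≟ q) (reachF (macroF d w) q′ r xs ys b))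

  Room : ℕ → SymStack → Set
  Room d w = Unique (pebbles w) × nX 𝒜 ≤ d + length w

  empty-room : Room (nX 𝒜) []
  empty-room = [] , ≤-reflexive (sym (+-identityʳ (nX 𝒜)))

  room-push : ∀ {d w x z} → Room (suc d) w → x ∉ pebbles w → Room d ((x , z) ∷ w)
  room-push {d} {w} (uniq , bound) x∉w =
    (¬Any⇒All¬ _ x∉w ∷ uniq) , subst (nX 𝒜 ≤_) (sym (+-suc d (length w))) bound

  room-exhausted : ∀ {w x} → Room zero w → x ∉ pebbles w → ⊥
  room-exhausted {w} (uniq , bound) x∉w =
    <-irrefl refl (≤-trans (unique-length (¬Any⇒All¬ _ x∉w ∷ uniq))
                           (subst (nX 𝒜 ≤_) (sym (length-map proj₁ w)) bound))

  push-below : ∀ {b x z w} → z < b → StackVars w ⊆ (_< b) → StackVars ((x , z) ∷ w) ⊆ (_< b)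
  push-below z<b w<b (here refl) = z<b
  push-below z<b w<b (there z∈) = w<b z∈

  applicableF : Op s k (nX 𝒜) → Vec ℕ k → ℕ → Formula s
  applicableF (inmove i σ)  ys b = testF [] (inedgeT i σ) ys b
  applicableF (outmove i σ) ys b = testF [] (outedgeT i σ) ys b
  applicableF (drop _ _)    ys b = ⊤ᶠ
  applicableF (retrieve _)  ys b = ⊥ᶠ
  applicableF (test t)      ys b = testF [] t ys b
  applicableF (ntest t)     ys b = neg (testF [] t ys b)

  enabledF : State → Vec ℕ k → ℕ → State × Op s k (nX 𝒜) × State → Formula s
  enabledF q ys b (p , χ , _) = guard (q Fin.≟ p) (applicableF χ ys b)

  haltF : State → Vec ℕ k → ℕ → Formula s
  haltF q ys b = neg (⋁ (enabledF q ys b) (instrs 𝒜))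

  -- variable 0 is the start node and 1, …, k hold the final head positions
  acceptF : State → Formula s
  acceptF q =
    guard (accepting 𝒜 q Bool.≟ true)
      (∃⃗ (range 1 k) (and (reachF (macroF (nX 𝒜) []) (q0 𝒜) q (replicate k 0) (range 1 k) (suc k))
                           (haltF q (range 1 k) (suc k))))

  acceptanceFormula : Formula s
  acceptanceFormula = all 0 (⋁ acceptF (allFin (nQ 𝒜)))

module Semantics {s k : ℕ} (𝒜 : Automaton s k) (g : Graph s) where

  open Macro 𝒜 g
  open Formulas 𝒜
  open Kleene {s} {k} {nQ 𝒜} using (reachF; reachF-defines)
  open DecMembership (Fin._≟_ {nX 𝒜}) using (_∈?_)

  ev : Valuation g → SymStack → Stack 𝒜 g
  ev ν = map (Product.map₂ ν)

  ev-agree : ∀ {c ν ν′} w → Agree c ν ν′ → StackVars w ⊆ (_< c) → ev ν w ≡ ev ν′ w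
  ev-agree []            ν≈ν′ w<c = refl
  ev-agree ((x , z) ∷ w) ν≈ν′ w<c = cong₂ _∷_ (cong (x ,_) (ν≈ν′ (w<c (here refl)))) (ev-agree w ν≈ν′ (w<c ∘ there))

  macroStep-local : ∀ {c} w → StackVars w ⊆ (_< c) → Local g c (λ ν → MacroStep (ev ν w))
  macroStep-local w w<c ν≈ν′ = subst (λ α → MacroStep α _ _) (ev-agree w ν≈ν′ w<c)

  fresh-⇔ : ∀ {ν x} w → x ∉ pebbles w ⇔ (∀ v → (x , v) ∉ ev ν w)
  fresh-⇔ {ν} {x} w = mk⇔ (λ x∉w v → x∉w ∘ pebble∈) (λ x-free → Product.uncurry x-free ∘ placed)
    where
      pebble∈ : ∀ {v} → (x , v) ∈ ev ν w → x ∈ pebbles w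
      pebble∈ x∈ with _ , m , refl ← find (Anyₚ.map⁻ x∈) = Anyₚ.map⁺ (lose m refl)

      placed : x ∈ pebbles w → ∃ λ v → (x , v) ∈ ev ν w
      placed x∈ with (_ , z) , m , refl ← find (Anyₚ.map⁻ x∈) = ν z , Anyₚ.map⁺ (lose m refl)

  update-outside : ∀ {b} {ν : Valuation g} {a : Node g} (xs : Vec ℕ k) → Vars xs ⊆ (_< b) →
                   ∀ i → (ν [ b ≔ a ]) (lookup xs i) ≡ lookup (mapV ν xs) i
  update-outside {b} {ν} {a} xs xs<b i =
    trans (update-other ν b a (<⇒≢ (xs<b (∈-lookupᵥ i xs)))) (sym (lookup-mapV ν xs i))

  testF-⇔ : ∀ {ν b} w t xs → Vars xs ⊆ (_< b) → Sat g ν (testF w t xs b) ⇔ Holds 𝒜 g t (mapV ν xs) (ev ν w)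
  testF-⇔ {ν} w (labT i σ) xs xs<b rewrite lookup-mapV ν xs i = mk⇔ id id
  testF-⇔ {ν} w (pebT i x) xs xs<b =
    mk⇔ (Anyₚ.map⁺ ∘ Any.map sound ∘ to (⋁-⇔ g _ w)) (from (⋁-⇔ g _ w) ∘ Any.map complete ∘ Anyₚ.map⁻)
    where
      sound : ∀ {(y , z) : Pebble × ℕ} → Sat g ν (guard (x Fin.≟ y) (eq z (lookup xs i))) →
              (x , lookup (mapV ν xs) i) ≡ (y , ν z)
      sound h with refl , z≡xᵢ ← to (guard-⇔ g (x Fin.≟ _)) h = cong (x ,_) (trans (lookup-mapV ν xs i) (sym z≡xᵢ))

      complete : ∀ {(y , z) : Pebble × ℕ} → (x , lookup (mapV ν xs) i) ≡ (y , ν z) →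
                 Sat g ν (guard (x Fin.≟ y) (eq z (lookup xs i)))
      complete {y , z} e with refl ← ,-injectiveˡ e =
        from (guard-⇔ g (x Fin.≟ x)) (refl , trans (sym (,-injectiveʳ e)) (lookup-mapV ν xs i))
  testF-⇔ {ν} {b} w (inedgeT i σ) xs xs<b =
    mk⇔ (λ (a , e , _ , t≡ , l) → e , trans t≡ (update-outside xs xs<b i) , l)
        (λ (e , t≡ , l) → src g e , e , sym (update-same ν b (src g e)) , trans t≡ (sym (update-outside xs xs<b i)) , l)
  testF-⇔ {ν} {b} w (outedgeT i σ) xs xs<b =
    mk⇔ (λ (a , e , s≡ , _ , l) → e , trans s≡ (update-outside xs xs<b i) , l)
        (λ (e , s≡ , l) → tgt g e , e , trans s≡ (sym (update-outside xs xs<b i)) , sym (update-same ν b (tgt g e)) , l)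

  heads-update-⇔ : ∀ {ν v} i (xs ys : Vec ℕ k) →
                   (Sat g ν (eqsExcept i xs ys) × ν (lookup ys i) ≡ v) ⇔ (mapV ν ys ≡ mapV ν xs [ i ]≔ v)
  heads-update-⇔ {ν} {v} i xs ys =
    mk⇔ (λ (h , yᵢ≡v) → trans (to (eqsExcept-⇔ g i xs ys) h)
                               (cong (mapV ν xs [ i ]≔_) (trans (lookup-mapV ν ys i) yᵢ≡v)))
        (λ ys≡ → let yᵢ≡v = trans (cong (λ u → lookup u i) ys≡) (VecP.lookup∘update i (mapV ν xs) v)
                 in from (eqsExcept-⇔ g i xs ys) (trans ys≡ (cong (mapV ν xs [ i ]≔_) (sym yᵢ≡v))) ,
                    trans (sym (lookup-mapV ν ys i)) yᵢ≡v)

  simpleF-⇔ : ∀ {ν b} w χ xs ys → Vars xs ⊆ (_< b) →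
              Sat g ν (simpleF w χ xs ys b) ⇔ (Simple χ × Exec 𝒜 g χ (mapV ν xs) (ev ν w) (mapV ν ys) (ev ν w))
  simpleF-⇔ {ν} w (inmove i σ) xs ys xs<b =
    mk⇔ (λ ((e , s≡ , t≡ , l) , h) →
           inmove , (e , trans t≡ (sym (lookup-mapV ν xs i)) , l , to (heads-update-⇔ i xs ys) (h , sym s≡)) , refl)
        (λ (_ , (e , t≡ , l , ys≡) , _) → let h , yᵢ≡ = from (heads-update-⇔ i xs ys) ys≡
                                           in (e , sym yᵢ≡ , trans t≡ (lookup-mapV ν xs i) , l) , h)
  simpleF-⇔ {ν} w (outmove i σ) xs ys xs<b =
    mk⇔ (λ ((e , s≡ , t≡ , l) , h) →
           outmove , (e , trans s≡ (sym (lookup-mapV ν xs i)) , l , to (heads-update-⇔ i xs ys) (h , sym t≡)) , refl)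
        (λ (_ , (e , s≡ , l , ys≡) , _) → let h , yᵢ≡ = from (heads-update-⇔ i xs ys) ys≡
                                           in (e , trans s≡ (lookup-mapV ν xs i) , sym yᵢ≡ , l) , h)
  simpleF-⇔ w (test t) xs ys xs<b =
    mk⇔ (λ (h , e) → test , to (testF-⇔ w t xs xs<b) h , sym (to (eqs-⇔ g xs ys) e) , refl)
        (λ (_ , H , e , _) → from (testF-⇔ w t xs xs<b) H , from (eqs-⇔ g xs ys) (sym e))
  simpleF-⇔ w (ntest t) xs ys xs<b =
    mk⇔ (λ (¬h , e) → ntest , ¬h ∘ from (testF-⇔ w t xs xs<b) , sym (to (eqs-⇔ g xs ys) e) , refl)
        (λ (_ , ¬H , e , _) → ¬H ∘ to (testF-⇔ w t xs xs<b) , from (eqs-⇔ g xs ys) (sym e))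
  simpleF-⇔ {ν} w (drop _ _)   xs ys xs<b = mk⇔ (⊥-elim ∘ ¬sat-⊥ᶠ g {ν}) λ { (() , _) }
  simpleF-⇔ {ν} w (retrieve _) xs ys xs<b = mk⇔ (⊥-elim ∘ ¬sat-⊥ᶠ g {ν}) λ { (() , _) }

  opF-simple : ∀ χ d {w q′ q xs ys b} → Simple χ → opF χ d w q′ q xs ys b ≡ guard (q′ Fin.≟ q) (simpleF w χ xs ys b)
  opF-simple _ d inmove  = refl
  opF-simple _ d outmove = refl
  opF-simple _ d test    = refl
  opF-simple _ d ntest   = refl

  simple-sound : ∀ χ {w p q′ q xs ys b ν} → (p , χ , q′) ∈ instrs 𝒜 → Vars xs ⊆ (_< b) →
                 Sat g ν (guard (q′ Fin.≟ q) (simpleF w χ xs ys b)) → MacroStep (ev ν w) (p , mapV ν xs) (q , mapV ν ys)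
  simple-sound χ {w} {q′ = q′} {q} {xs} {ys} ι xs<b h
    with refl , h′ ← to (guard-⇔ g (q′ Fin.≟ q)) h
    with sm , exec ← to (simpleF-⇔ w χ xs ys xs<b) h′ = simple ι sm exec

  instrF-intro : ∀ {d w p χ q′ q xs ys b ν} → (p , χ , q′) ∈ instrs 𝒜 →
                 Sat g ν (opF χ d w q′ q xs ys b) → Sat g ν (macroF d w p q xs ys b)
  instrF-intro {p = p} ι h = from (⋁-⇔ g _ (instrs 𝒜)) (lose ι (from (guard-⇔ g (p Fin.≟ p)) (refl , h)))

  retrieveF-intro : ∀ {d w x q′ r q xs ys b ν} → (r , retrieve x , q) ∈ instrs 𝒜 →
                    Sat g ν (reachF (macroF d w) q′ r xs ys b) → Sat g ν (⋁ (retrieveF d w x q′ q xs ys b) (instrs 𝒜))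
  retrieveF-intro {x = x} {q = q} ι h =
    from (⋁-⇔ g _ (instrs 𝒜))
         (lose ι (from (guard-⇔ g (retrieve? x (retrieve x))) (refl , from (guard-⇔ g (q Fin.≟ q)) (refl , h))))

  mutual
    macroF-defines : ∀ d w {c} → Room d w → StackVars w ⊆ (_< c) → Defines g (macroF d w) c (λ ν → MacroStep (ev ν w))
    macroF-defines d w room w<c {b = b} c≤b xs<b ys<b =
      mk⇔ (macroF-sound d w room w<b xs<b ys<b) (macroF-complete d w room w<b xs<b ys<b)
      where
        w<b : StackVars w ⊆ (_< b)
        w<b z∈ = <-≤-trans (w<c z∈) c≤b

    nested-run-⇔ : ∀ d w {i x q′ r xs ys b ν} → Room (suc d) w → x ∉ pebbles w →
                   StackVars w ⊆ (_< b) → Vars xs ⊆ (_< b) → Vars ys ⊆ (_< b) →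
                   Sat g ν (reachF (macroF d ((x , lookup xs i) ∷ w)) q′ r xs ys b) ⇔
                   Star (MacroStep ((x , lookup (mapV ν xs) i) ∷ ev ν w)) (q′ , mapV ν xs) (r , mapV ν ys)
    nested-run-⇔ d w {i} {x} {q′} {r} {xs} {ys} {b} {ν} room x∉w w<b xs<b ys<b =
      subst (λ v → Sat g ν (reachF (macroF d w′) q′ r xs ys b) ⇔
                   Star (MacroStep ((x , v) ∷ ev ν w)) (q′ , mapV ν xs) (r , mapV ν ys))
            (sym (lookup-mapV ν xs i))
            (reachF-defines (macroStep-local w′ w′<b)
                            (macroF-defines d w′ (room-push {z = lookup xs i} room x∉w) w′<b) ≤-refl xs<b ys<b)
      where
        w′ : SymStack
        w′ = (x , lookup xs i) ∷ w

        w′<b : StackVars w′ ⊆ (_< b)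
        w′<b = push-below {x = x} (xs<b (∈-lookupᵥ i xs)) w<b

    macroF-sound : ∀ d w {p q xs ys b ν} → Room d w → StackVars w ⊆ (_< b) → Vars xs ⊆ (_< b) → Vars ys ⊆ (_< b) →
                   Sat g ν (macroF d w p q xs ys b) → MacroStep (ev ν w) (p , mapV ν xs) (q , mapV ν ys)
    macroF-sound d w {p} {q} {xs} {ys} {b} room w<b xs<b ys<b h
      with (p′ , χ , q′) , ι , h′ ← find (to (⋁-⇔ g (instrF d w p q xs ys b) (instrs 𝒜)) h)
      with refl , h″ ← to (guard-⇔ g (p Fin.≟ p′)) h′
      = op-sound χ d ι room w<b xs<b ys<b h″

    op-sound : ∀ χ d {w p q′ q xs ys b ν} → (p , χ , q′) ∈ instrs 𝒜 → Room d w →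
               StackVars w ⊆ (_< b) → Vars xs ⊆ (_< b) → Vars ys ⊆ (_< b) →
               Sat g ν (opF χ d w q′ q xs ys b) → MacroStep (ev ν w) (p , mapV ν xs) (q , mapV ν ys)
    op-sound (drop i x) zero {ν = ν} ι room w<b xs<b ys<b h = ⊥-elim (¬sat-⊥ᶠ g {ν} h)
    op-sound (drop i x) (suc d) {w} {q′ = q′} {q} {xs} {ys} {b} ι room w<b xs<b ys<b h
      with x∉w , h′ ← to (guard-⇔ g (¬? (x ∈? pebbles w))) h
      with (r , χ , q″) , ιr , h″ ← find (to (⋁-⇔ g (retrieveF d ((x , lookup xs i) ∷ w) x q′ q xs ys b) _) h′)
      with refl , h‴ ← to (guard-⇔ g (retrieve? x χ)) h″
      with refl , run ← to (guard-⇔ g (q″ Fin.≟ q)) h‴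
      = nested ι (to (fresh-⇔ w) x∉w) (to (nested-run-⇔ d w room x∉w w<b xs<b ys<b) run) ιr
    op-sound χ@(inmove _ _)  d ι room w<b xs<b ys<b h = simple-sound χ ι xs<b h
    op-sound χ@(outmove _ _) d ι room w<b xs<b ys<b h = simple-sound χ ι xs<b h
    op-sound χ@(test _)      d ι room w<b xs<b ys<b h = simple-sound χ ι xs<b h
    op-sound χ@(ntest _)     d ι room w<b xs<b ys<b h = simple-sound χ ι xs<b h
    op-sound χ@(retrieve _)  d ι room w<b xs<b ys<b h = simple-sound χ ι xs<b h

    macroF-complete : ∀ d w {p q xs ys b ν} → Room d w → StackVars w ⊆ (_< b) → Vars xs ⊆ (_< b) → Vars ys ⊆ (_< b) →
                     MacroStep (ev ν w) (p , mapV ν xs) (q , mapV ν ys) → Sat g ν (macroF d w p q xs ys b)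
    macroF-complete d w {q = q} {xs} {ys} {ν = ν} room w<b xs<b ys<b (simple {χ = χ} ι sm exec) =
      instrF-intro ι (subst (Sat g ν) (sym (opF-simple χ d sm))
                       (from (guard-⇔ g (q Fin.≟ q)) (refl , from (simpleF-⇔ w χ xs ys xs<b) (sm , exec))))
    macroF-complete zero w room w<b xs<b ys<b (nested ι x-free _ _) =
      ⊥-elim (room-exhausted room (from (fresh-⇔ w) x-free))
    macroF-complete (suc d) w room w<b xs<b ys<b (nested {x = x} ι x-free run ιr) =
      instrF-intro ι (from (guard-⇔ g (¬? (x ∈? pebbles w)))
                        (x∉w , retrieveF-intro ιr (from (nested-run-⇔ d w room x∉w w<b xs<b ys<b) run)))
      where
        x∉w : x ∉ pebbles w
        x∉w = from (fresh-⇔ w) x-free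

  Applicable : Op s k (nX 𝒜) → Heads 𝒜 g → Set
  Applicable χ u = ∃₂ λ u′ α′ → Exec 𝒜 g χ u [] u′ α′

  applicableF-⇔ : ∀ {ν b} χ ys → Vars ys ⊆ (_< b) → Sat g ν (applicableF χ ys b) ⇔ Applicable χ (mapV ν ys)
  applicableF-⇔ (inmove i σ) ys ys<b =
    mk⇔ (λ h → let e , t≡ , l = to (testF-⇔ [] (inedgeT i σ) ys ys<b) h in _ , _ , (e , t≡ , l , refl) , refl)
        (λ (_ , _ , (e , t≡ , l , _) , _) → from (testF-⇔ [] (inedgeT i σ) ys ys<b) (e , t≡ , l))
  applicableF-⇔ (outmove i σ) ys ys<b =
    mk⇔ (λ h → let e , s≡ , l = to (testF-⇔ [] (outedgeT i σ) ys ys<b) h in _ , _ , (e , s≡ , l , refl) , refl)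
        (λ (_ , _ , (e , s≡ , l , _) , _) → from (testF-⇔ [] (outedgeT i σ) ys ys<b) (e , s≡ , l))
  applicableF-⇔ {ν} (drop _ _) ys ys<b = mk⇔ (λ _ → _ , _ , (λ v ()) , refl , refl) (λ _ → sat-⊤ᶠ g ν)
  applicableF-⇔ {ν} (retrieve _) ys ys<b = mk⇔ (⊥-elim ∘ ¬sat-⊥ᶠ g {ν}) λ { (_ , _ , _ , _ , ()) }
  applicableF-⇔ (test t) ys ys<b =
    mk⇔ (λ h → _ , _ , to (testF-⇔ [] t ys ys<b) h , refl , refl)
        (λ (_ , _ , H , _) → from (testF-⇔ [] t ys ys<b) H)
  applicableF-⇔ (ntest t) ys ys<b =
    mk⇔ (λ ¬h → _ , _ , ¬h ∘ from (testF-⇔ [] t ys ys<b) , refl , refl)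
        (λ (_ , _ , ¬H , _) → ¬H ∘ to (testF-⇔ [] t ys ys<b))

  haltF-⇔ : ∀ {ν b} q ys → Vars ys ⊆ (_< b) → Sat g ν (haltF q ys b) ⇔ Halting 𝒜 g (q , mapV ν ys , [])
  haltF-⇔ {ν} {b} q ys ys<b = mk⇔ (λ ¬enabled → ¬enabled ∘ enabled) (λ halting → halting ∘ step)
    where
      enabled : ∃ (Step 𝒜 g (q , mapV ν ys , [])) → Sat g ν (⋁ (enabledF q ys b) (instrs 𝒜))
      enabled ((_ , u′ , α′) , χ , ι , exec) =
        from (⋁-⇔ g _ (instrs 𝒜))
             (lose ι (from (guard-⇔ g (q Fin.≟ q)) (refl , from (applicableF-⇔ χ ys ys<b) (u′ , α′ , exec))))

      step : Sat g ν (⋁ (enabledF q ys b) (instrs 𝒜)) → ∃ (Step 𝒜 g (q , mapV ν ys , []))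
      step h with (p , χ , q′) , ι , h′ ← find (to (⋁-⇔ g _ (instrs 𝒜)) h)
             with refl , h″ ← to (guard-⇔ g (q Fin.≟ p)) h′
             with u′ , α′ , exec ← to (applicableF-⇔ χ ys ys<b) h″ = (q′ , u′ , α′) , χ , ι , exec

  initial-run-⇔ : ∀ ν u q v →
                  Sat g ((ν [ 0 ≔ u ]) [ range 1 k ≔* v ])
                        (reachF (macroF (nX 𝒜) []) (q0 𝒜) q (replicate k 0) (range 1 k) (suc k)) ⇔
                  Star (MacroStep []) (q0 𝒜 , replicate k u) (q , v)
  initial-run-⇔ ν u q v =
    subst₂ (λ u₀ v₀ → Sat g ν′ (reachF (macroF (nX 𝒜) []) (q0 𝒜) q (replicate k 0) (range 1 k) (suc k)) ⇔
                      Star (MacroStep []) (q0 𝒜 , u₀) (q , v₀))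
           start (mapV-updates-range (ν [ 0 ≔ u ]) 1 k v)
           (reachF-defines (macroStep-local [] λ ()) (macroF-defines (nX 𝒜) [] empty-room λ ()) z≤n
                           (replicate-below (s≤s z≤n)) (range-below ≤-refl))
    where
      ν′ : Valuation g
      ν′ = (ν [ 0 ≔ u ]) [ range 1 k ≔* v ]

      start : mapV ν′ (replicate k 0) ≡ replicate k u
      start = trans (mapV-replicate ν′ 0)
                    (cong (replicate k) (trans (updates-below (ν [ 0 ≔ u ]) 1 k v (s≤s z≤n)) (update-same ν 0 u)))

  accepts-⇔ : ∀ ν u → Sat g (ν [ 0 ≔ u ]) (⋁ acceptF (allFin (nQ 𝒜))) ⇔ Acc 𝒜 g u
  accepts-⇔ ν u = mk⇔ sound complete
    where
      halting-⇔ : ∀ q v → Sat g ((ν [ 0 ≔ u ]) [ range 1 k ≔* v ]) (haltF q (range 1 k) (suc k)) ⇔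
                          Halting 𝒜 g (q , v , [])
      halting-⇔ q v =
        subst (λ v′ → Sat g ((ν [ 0 ≔ u ]) [ range 1 k ≔* v ]) (haltF q (range 1 k) (suc k)) ⇔
                      Halting 𝒜 g (q , v′ , []))
              (mapV-updates-range (ν [ 0 ≔ u ]) 1 k v) (haltF-⇔ q (range 1 k) (range-below ≤-refl))

      sound : Sat g (ν [ 0 ≔ u ]) (⋁ acceptF (allFin (nQ 𝒜))) → Acc 𝒜 g u
      sound h with q , _ , h′ ← find (to (⋁-⇔ g acceptF (allFin (nQ 𝒜))) h)
              with acc , h″ ← to (guard-⇔ g (accepting 𝒜 q Bool.≟ true)) h′
              with v , run , halt ← to (∃⃗-⇔ g (range 1 k) _) h″ =
        q , v , macroSteps⇒steps (to (initial-run-⇔ ν u q v) run) , acc , to (halting-⇔ q v) halt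

      complete : Acc 𝒜 g u → Sat g (ν [ 0 ≔ u ]) (⋁ acceptF (allFin (nQ 𝒜)))
      complete (q , v , steps , acc , halt) =
        from (⋁-⇔ g acceptF (allFin (nQ 𝒜)))
             (lose (∈-allFin q) (from (guard-⇔ g (accepting 𝒜 q Bool.≟ true))
                                      (acc , from (∃⃗-⇔ g (range 1 k) _)
                                                  (v , from (initial-run-⇔ ν u q v) (steps⇒macroSteps steps) ,
                                                       from (halting-⇔ q v) halt))))

  acceptanceFormula-⇔ : g ∈L 𝒜 ⇔ g ⊨ acceptanceFormula
  acceptanceFormula-⇔ = mk⇔ (λ accepts ν u → from (accepts-⇔ ν u) (accepts u))
                            (λ sat u → to (accepts-⇔ (λ _ → u) u) (sat (λ _ → u) u))

module Scoping {s k : ℕ} (𝒜 : Automaton s k) where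

  open Formulas 𝒜
  open Kleene {s} {k} {nQ 𝒜} using (reachF; reachF-scoped)
  open DecMembership (Fin._≟_ {nX 𝒜}) using (_∈?_)

  testF-scoped : ∀ w t xs b → Fv (testF w t xs b) ⊆ StackVars w ∪ Vars xs
  testF-scoped w (labT i σ) xs b refl = inj₂ (∈-lookupᵥ i xs)
  testF-scoped w (pebT i x) xs b =
    Fv-⋁ {P = StackVars w ∪ Vars xs} (λ (y , z) → guard (x Fin.≟ y) (eq z (lookup xs i))) w λ {(y , z)} yz∈w →
      Sum.[ (λ { refl → inj₁ (∈-map⁺ proj₂ yz∈w) }) , (λ { refl → inj₂ (∈-lookupᵥ i xs) }) ]
      ∘ Fv-guard (x Fin.≟ y) (eq z (lookup xs i))
  testF-scoped w (inedgeT i σ)  xs b (z≢b , inj₁ z≡b)  = ⊥-elim (z≢b z≡b)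
  testF-scoped w (inedgeT i σ)  xs b (_   , inj₂ refl) = inj₂ (∈-lookupᵥ i xs)
  testF-scoped w (outedgeT i σ) xs b (_   , inj₁ refl) = inj₂ (∈-lookupᵥ i xs)
  testF-scoped w (outedgeT i σ) xs b (z≢b , inj₂ z≡b)  = ⊥-elim (z≢b z≡b)

  simpleF-scoped : ∀ w χ xs ys b → Fv (simpleF w χ xs ys b) ⊆ (StackVars w ∪ Vars xs) ∪ Vars ys
  simpleF-scoped w (inmove i σ)  xs ys b (inj₁ (inj₁ refl)) = inj₂ (∈-lookupᵥ i ys)
  simpleF-scoped w (inmove i σ)  xs ys b (inj₁ (inj₂ refl)) = inj₁ (inj₂ (∈-lookupᵥ i xs))
  simpleF-scoped w (inmove i σ)  xs ys b (inj₂ z∈)          = Sum.map₁ inj₂ (Fv-eqsExcept i xs ys z∈)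
  simpleF-scoped w (outmove i σ) xs ys b (inj₁ (inj₁ refl)) = inj₁ (inj₂ (∈-lookupᵥ i xs))
  simpleF-scoped w (outmove i σ) xs ys b (inj₁ (inj₂ refl)) = inj₂ (∈-lookupᵥ i ys)
  simpleF-scoped w (outmove i σ) xs ys b (inj₂ z∈)          = Sum.map₁ inj₂ (Fv-eqsExcept i xs ys z∈)
  simpleF-scoped w (test t)      xs ys b (inj₁ z∈)          = inj₁ (testF-scoped w t xs b z∈)
  simpleF-scoped w (test t)      xs ys b (inj₂ z∈)          = Sum.map₁ inj₂ (Fv-eqs xs ys z∈)
  simpleF-scoped w (ntest t)     xs ys b (inj₁ z∈)          = inj₁ (testF-scoped w t xs b z∈)
  simpleF-scoped w (ntest t)     xs ys b (inj₂ z∈)          = Sum.map₁ inj₂ (Fv-eqs xs ys z∈)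
  simpleF-scoped w (drop _ _)    xs ys b                    = ⊥-elim ∘ ∉Fv-⊥ᶠ {s}
  simpleF-scoped w (retrieve _)  xs ys b                    = ⊥-elim ∘ ∉Fv-⊥ᶠ {s}

  simple-scoped : ∀ χ w (q′ q : State) xs ys b {P : Pred ℕ 0ℓ} → StackVars w ⊆ P → Vars xs ⊆ P → Vars ys ⊆ P →
                  Fv (guard (q′ Fin.≟ q) (simpleF w χ xs ys b)) ⊆ P
  simple-scoped χ w q′ q xs ys b w⊆P xs⊆P ys⊆P =
    Sum.[ Sum.[ w⊆P , xs⊆P ] , ys⊆P ] ∘ simpleF-scoped w χ xs ys b ∘ Fv-guard (q′ Fin.≟ q) (simpleF w χ xs ys b)

  mutual
    macroF-scoped : ∀ d w → Scoped (macroF d w) (StackVars w)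
    macroF-scoped d w {P} {p} {q} {xs} {ys} {b} w⊆P xs⊆P ys⊆P =
      Fv-⋁ {P = P} (instrF d w p q xs ys b) (instrs 𝒜) λ {(p′ , χ , q′)} _ →
        op-scoped χ d w q′ q xs ys b w⊆P xs⊆P ys⊆P ∘ Fv-guard (p Fin.≟ p′) (opF χ d w q′ q xs ys b)

    op-scoped : ∀ χ d w q′ q xs ys b {P : Pred ℕ 0ℓ} → StackVars w ⊆ P → Vars xs ⊆ P → Vars ys ⊆ P →
                Fv (opF χ d w q′ q xs ys b) ⊆ P
    op-scoped (drop i x) zero    w q′ q xs ys b w⊆P xs⊆P ys⊆P = ⊥-elim ∘ ∉Fv-⊥ᶠ {s}
    op-scoped (drop i x) (suc d) w q′ q xs ys b {P} w⊆P xs⊆P ys⊆P =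
      Fv-⋁ {P = P} (retrieveF d w′ x q′ q xs ys b) (instrs 𝒜) (λ {(r , χ , q″)} _ →
          reachF-scoped (macroF-scoped d w′) {P} {q′} {r} {xs} {ys} {b} w′⊆P xs⊆P ys⊆P
          ∘ Fv-guard (q″ Fin.≟ q) (reachF (macroF d w′) q′ r xs ys b)
          ∘ Fv-guard (retrieve? x χ) _)
      ∘ Fv-guard (¬? (x ∈? pebbles w)) _
      where
        w′ : SymStack
        w′ = (x , lookup xs i) ∷ w

        w′⊆P : StackVars w′ ⊆ P
        w′⊆P (here refl) = xs⊆P (∈-lookupᵥ i xs)
        w′⊆P (there z∈)  = w⊆P z∈
    op-scoped χ@(inmove _ _)  d = simple-scoped χ
    op-scoped χ@(outmove _ _) d = simple-scoped χ
    op-scoped χ@(test _)      d = simple-scoped χ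
    op-scoped χ@(ntest _)     d = simple-scoped χ
    op-scoped χ@(retrieve _)  d = simple-scoped χ

  applicableF-scoped : ∀ χ ys b → Fv (applicableF χ ys b) ⊆ Vars ys
  applicableF-scoped (inmove i σ)  ys b = Sum.[ (λ ()) , id ] ∘ testF-scoped [] (inedgeT i σ) ys b
  applicableF-scoped (outmove i σ) ys b = Sum.[ (λ ()) , id ] ∘ testF-scoped [] (outedgeT i σ) ys b
  applicableF-scoped (drop _ _)    ys b = ⊥-elim ∘ ∉Fv-⊤ᶠ {s}
  applicableF-scoped (retrieve _)  ys b = ⊥-elim ∘ ∉Fv-⊥ᶠ {s}
  applicableF-scoped (test t)      ys b = Sum.[ (λ ()) , id ] ∘ testF-scoped [] t ys b
  applicableF-scoped (ntest t)     ys b = Sum.[ (λ ()) , id ] ∘ testF-scoped [] t ys b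

  haltF-scoped : ∀ q ys b → Fv (haltF q ys b) ⊆ Vars ys
  haltF-scoped q ys b = Fv-⋁ {P = Vars ys} (enabledF q ys b) (instrs 𝒜) λ {(p , χ , _)} _ →
    applicableF-scoped χ ys b ∘ Fv-guard (q Fin.≟ p) (applicableF χ ys b)

  acceptanceFormula-closed : Closed acceptanceFormula
  acceptanceFormula-closed z (z≢0 , z∈) =
    z≢0 (Fv-⋁ {P = _≡ 0} acceptF (allFin (nQ 𝒜)) (λ {q} _ → acceptF-scoped q) z∈)
    where
      acceptF-scoped : ∀ q → Fv (acceptF q) ⊆ (_≡ 0)
      acceptF-scoped q = Fv-∃⃗ {P = _≡ 0} (range 1 k) _ body ∘ Fv-guard (accepting 𝒜 q Bool.≟ true) _
        where
          body : Fv (and (reachF (macroF (nX 𝒜) []) (q0 𝒜) q (replicate k 0) (range 1 k) (suc k))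
                          (haltF q (range 1 k) (suc k))) ⊆ (_≡ 0) ∪ Vars (range 1 k)
          body (inj₁ z∈) =
            reachF-scoped (macroF-scoped (nX 𝒜) []) {(_≡ 0) ∪ Vars (range 1 k)} {q0 𝒜} {q} {b = suc k}
                          (λ ()) (inj₁ ∘ ∈-replicate⁻) inj₂ z∈
          body (inj₂ z∈) = inj₂ (haltF-scoped q (range 1 k) (suc k) z∈)

module DTC {s k : ℕ} (𝒜 : Automaton s k) (det : Deterministic 𝒜) where

  open Formulas 𝒜
  open Kleene {s} {k} {nQ 𝒜} using (reachF; reachF-dtc)
  open DecMembership (Fin._≟_ {nX 𝒜}) using (_∈?_)

  testF-dtc : ∀ w t xs b → IsDTC k (testF w t xs b)
  testF-dtc w (labT i σ)     xs b = tt
  testF-dtc w (pebT i x)     xs b = dtc-⋁ _ w λ (y , z) → dtc-guard (x Fin.≟ y) λ _ → tt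
  testF-dtc w (inedgeT i σ)  xs b = tt
  testF-dtc w (outedgeT i σ) xs b = tt

  simpleF-dtc : ∀ w χ xs ys b → IsDTC k (simpleF w χ xs ys b)
  simpleF-dtc w (inmove i σ)  xs ys b = tt , dtc-eqsExcept i xs ys
  simpleF-dtc w (outmove i σ) xs ys b = tt , dtc-eqsExcept i xs ys
  simpleF-dtc w (test t)      xs ys b = testF-dtc w t xs b , dtc-eqs xs ys
  simpleF-dtc w (ntest t)     xs ys b = testF-dtc w t xs b , dtc-eqs xs ys
  simpleF-dtc w (drop _ _)    xs ys b = tt
  simpleF-dtc w (retrieve _)  xs ys b = tt

  mutual
    macroF-dtc : ∀ d w {c} → Room d w → StackVars w ⊆ (_< c) → InDTC (macroF d w) c
    macroF-dtc d w room w<c {p} {q} {xs} {ys} {b} c≤b xs<b ys<b =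
      dtc-⋁ (instrF d w p q xs ys b) (instrs 𝒜) λ (p′ , χ , q′) →
        dtc-guard (p Fin.≟ p′) λ _ → op-dtc χ d w q′ q xs ys b room (λ z∈ → <-≤-trans (w<c z∈) c≤b) xs<b ys<b

    op-dtc : ∀ χ d w q′ q xs ys b → Room d w → StackVars w ⊆ (_< b) → Vars xs ⊆ (_< b) → Vars ys ⊆ (_< b) →
             IsDTC k (opF χ d w q′ q xs ys b)
    op-dtc (drop i x) zero    w q′ q xs ys b room w<b xs<b ys<b = tt
    op-dtc (drop i x) (suc d) w q′ q xs ys b room w<b xs<b ys<b =
      dtc-guard (¬? (x ∈? pebbles w)) λ x∉w →
        dtc-⋁ (retrieveF d w′ x q′ q xs ys b) (instrs 𝒜) λ (r , χ , q″) →
          dtc-guard (retrieve? x χ) λ _ → dtc-guard (q″ Fin.≟ q) λ _ →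
            reachF-dtc (λ g → Semantics.macroStep-local 𝒜 g w′ w′<b)
                       (λ g → Semantics.macroF-defines 𝒜 g d w′ (room′ x∉w) w′<b)
                       (λ g ν → Macro.Determinism.macroStep-deterministic 𝒜 g det)
                       (macroF-dtc d w′ (room′ x∉w) w′<b) ≤-refl xs<b ys<b
      where
        w′ : SymStack
        w′ = (x , lookup xs i) ∷ w

        w′<b : StackVars w′ ⊆ (_< b)
        w′<b = push-below {x = x} (xs<b (∈-lookupᵥ i xs)) w<b

        room′ : x ∉ pebbles w → Room d w′
        room′ = room-push {z = lookup xs i} room
    op-dtc χ@(inmove _ _)  d w q′ q xs ys b _ _ _ _ = dtc-guard (q′ Fin.≟ q) λ _ → simpleF-dtc w χ xs ys b
    op-dtc χ@(outmove _ _) d w q′ q xs ys b _ _ _ _ = dtc-guard (q′ Fin.≟ q) λ _ → simpleF-dtc w χ xs ys b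
    op-dtc χ@(test _)      d w q′ q xs ys b _ _ _ _ = dtc-guard (q′ Fin.≟ q) λ _ → simpleF-dtc w χ xs ys b
    op-dtc χ@(ntest _)     d w q′ q xs ys b _ _ _ _ = dtc-guard (q′ Fin.≟ q) λ _ → simpleF-dtc w χ xs ys b
    op-dtc χ@(retrieve _)  d w q′ q xs ys b _ _ _ _ = dtc-guard (q′ Fin.≟ q) λ _ → simpleF-dtc w χ xs ys b

  applicableF-dtc : ∀ χ ys b → IsDTC k (applicableF χ ys b)
  applicableF-dtc (inmove i σ)  ys b = tt
  applicableF-dtc (outmove i σ) ys b = tt
  applicableF-dtc (drop _ _)    ys b = tt
  applicableF-dtc (retrieve _)  ys b = tt
  applicableF-dtc (test t)      ys b = testF-dtc [] t ys b
  applicableF-dtc (ntest t)     ys b = testF-dtc [] t ys b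

  acceptanceFormula-dtc : IsDTC k acceptanceFormula
  acceptanceFormula-dtc =
    dtc-⋁ acceptF (allFin (nQ 𝒜)) λ q → dtc-guard (accepting 𝒜 q Bool.≟ true) λ _ → dtc-∃⃗ (range 1 k)
      ( initial-run-dtc q
      , dtc-⋁ (enabledF q (range 1 k) (suc k)) (instrs 𝒜)
          (λ (p , χ , _) → dtc-guard (q Fin.≟ p) λ _ → applicableF-dtc χ (range 1 k) (suc k)))
    where
      initial-run-dtc : ∀ q → IsDTC k (reachF (macroF (nX 𝒜) []) (q0 𝒜) q (replicate k 0) (range 1 k) (suc k))
      initial-run-dtc q =
        reachF-dtc (λ g → Semantics.macroStep-local 𝒜 g [] λ ())
                   (λ g → Semantics.macroF-defines 𝒜 g (nX 𝒜) [] empty-room λ ())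
                   (λ g ν → Macro.Determinism.macroStep-deterministic 𝒜 g det)
                   (macroF-dtc (nX 𝒜) [] empty-room λ ()) z≤n (replicate-below (s≤s z≤n)) (range-below ≤-refl)

lemma7p1 : (s : ℕ) (F : Graph s → Set) (k : ℕ) → 1 ≤ k →
           (𝒜 : Automaton s k) → WellFormed 𝒜 → Deterministic 𝒜 →
           Σ (Formula s) (λ φ → IsDTC k φ × Closed φ ×
             ((g : Graph s) → F g → (g ∈L 𝒜 ⇔ g ⊨ φ)))
lemma7p1 s F k _ 𝒜 _ det =
  Formulas.acceptanceFormula 𝒜 ,
  DTC.acceptanceFormula-dtc 𝒜 det ,
  Scoping.acceptanceFormula-closed 𝒜 ,
  λ g _ → Semantics.acceptanceFormula-⇔ 𝒜 g
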